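{- There is an algorithm on a random access machine which, given $n,m\in\mathbb{N}$ with $n,m\ge1$ and a very good instruction sequence $X$ with $\mathrm{len}(X)=L(n)+m$ and $\mathrm{iregs}(X)=\{1,\dots,n\}$, decides whether $X$ computes $\mathrm{tstnz}_n$ in time $O(n\cdot(n+m))$.
   Context: Basic instructions: $\mathtt{in}{:}i.\mathtt{get}$ ($i\ge1$), $\mathtt{out}.\mathtt{set}{:}b$ ($b\in\{0,1\}$), $\mathtt{aux}{:}i.\mathtt{get}$ ($i\ge1$), $\mathtt{aux}{:}i.\mathtt{set}{:}b$ ($i\ge1$, $b\in\{0,1\}$). The part before the dot names a Boolean register ($\mathtt{in}{:}i$ input, $\mathtt{out}$ output, $\mathtt{aux}{:}i$ auxiliary); $\mathtt{get}$ changes nothing and replies the content, $\mathtt{set}{:}b$ makes the content $b$ and replies $b$. Primitive instructions: for each basic instruction $a$, plain $a$, positive test $+a$, negative test $-a$; forward jumps $\#l$ ($l\in\mathbb{N}$); termination $!$. Instruction sequences are finite sequences $X=u_1;\dots;u_k$ of primitive instructions, $\mathrm{len}(X)=k$. Execution starts at $u_1$: plain $a$ executes $a$ and proceeds with the next instruction; $+a$ executes $a$ and proceeds with the next instruction if the reply is $1$, otherwise skips the next one and proceeds with the one after it; $-a$ likewise with replies reversed; $\#l$ proceeds with the $l$-th next instruction; $!$ terminates. If $l=0$ or there is no instruction to proceed with, execution never terminates. For $f:\{0,1\}^n\to\{0,1\}$, $X$ computes $f$ if there is $k$ such that for all $b_1,\dots,b_n$, executing $X$ with $\mathtt{in}{:}i$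 initially $b_i$, $\mathtt{out}$ and $\mathtt{aux}{:}1,\dots,\mathtt{aux}{:}k$ initially $0$ terminates with final content of $\mathtt{out}$ equal to $f(b_1,\dots,b_n)$. $\mathrm{tstnz}_n(b_1,\dots,b_n)=1$ iff some $b_i=1$. $L(n)=3n/2+1$ for even $n$, $3(n+1)/2$ for odd $n$. Read instructions are $+\mathtt{in}{:}i.\mathtt{get}$ and $-\mathtt{in}{:}i.\mathtt{get}$; $\mathrm{iregs}(X)$ is the set of $i$ such that $\mathtt{in}{:}i$ is read by some read instruction occurring in $X$. A good instruction sequence is one of the form $Z;\mathtt{out}.\mathtt{set}{:}1;!$ where only read instructions and forward jumps $\#l$ with $l>0$ occur in $Z$; a very good instruction sequence is a good one in which no input register name appears in more than one occurrence of a read instruction. Model: random access machine in the sense of Cook and Reckhow (without multiplication/division), uniform cost criterion; each primitive instruction of the input is represented by two integers (its form and its natural-number parameter, or $-1$ if none). -}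

module Defs where

open import Data.Nat using (ℕ; zero; suc; _+_; _*_; _≤_; _≡ᵇ_; _<ᵇ_)
open import Data.Nat.DivMod using (_/_; _%_)
open import Data.Bool using (Bool; true; false; if_then_else_; _∨_)
open import Data.Integer using (ℤ; +_; -[1+_]; _-_) renaming (_+_ to _+ℤ_)
open import Data.List using (List; []; _∷_; _++_; concatMap; mapMaybe)
open import Data.List.Relation.Unary.All using (All)
open import Data.List.Relation.Unary.Unique.Propositional using (Unique)
open import Data.List.Membership.Propositional using (_∈_)
open import Data.Maybe using (Maybe; just; nothing)
open import Data.Vec using (Vec; lookup) renaming ([] to []ᵥ; _∷_ to _∷ᵥ_)
open import Data.Fin using (Fin; toℕ)
open import Data.Product using (Σ; _×_; _,_; ∃)
open import Function.Bundles using (_⇔_)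
open import Relation.Binary.PropositionalEquality using (_≡_)

-- Basic instructions.  Register indices are natural numbers; the paper
-- only uses indices i ≥ 1 (the hypotheses of lemma5 guarantee this for
-- the sequences considered).
data BasicInstr : Set where
  inGet  : ℕ → BasicInstr
  outSet : Bool → BasicInstr
  auxGet : ℕ → BasicInstr
  auxSet : ℕ → Bool → BasicInstr

data PrimInstr : Set where
  plain : BasicInstr → PrimInstr
  pos   : BasicInstr → PrimInstr
  neg   : BasicInstr → PrimInstr
  jmp   : ℕ → PrimInstr
  term  : PrimInstr

InstrSeq : Set
InstrSeq = List PrimInstr

len : InstrSeq → ℕ
len = Data.List.length

record RegState : Set where
  constructor regs
  field
    inR  : ℕ → Bool
    outR : Bool
    auxR : ℕ → Bool
open RegState public

update : (ℕ → Bool) → ℕ → Bool → ℕ → Bool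
update f i b j = if j ≡ᵇ i then b else f j

execBasic : BasicInstr → RegState → Bool × RegState
execBasic (inGet i)    s = inR s i , s
execBasic (outSet b)   s = b , regs (inR s) b (auxR s)
execBasic (auxGet i)   s = auxR s i , s
execBasic (auxSet i b) s = b , regs (inR s) (outR s) (update (auxR s) i b)

nth : InstrSeq → ℕ → Maybe PrimInstr
nth []       _       = nothing
nth (u ∷ _)  zero    = just u
nth (_ ∷ us) (suc p) = nth us p

-- run for at most t steps from position p (0-based);
-- just s  = terminated (by !) within t steps with final state s.
-- No instruction to proceed with, or #0, never terminates.
runIS : ℕ → InstrSeq → ℕ → RegState → Maybe RegState
runIS zero    X p s = nothing
runIS (suc t) X p s with nth X p
... | nothing        = nothing
... | just term      = just s
... | just (jmp l)   = runIS t X (p + l) s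
... | just (plain a) with execBasic a s
...   | (r , s') = runIS t X (suc p) s'
runIS (suc t) X p s | just (pos a) with execBasic a s
...   | (r , s') = runIS t X (if r then suc p else suc (suc p)) s'
runIS (suc t) X p s | just (neg a) with execBasic a s
...   | (r , s') = runIS t X (if r then suc (suc p) else suc p) s'

TerminatesWithOut : InstrSeq → RegState → Bool → Set
TerminatesWithOut X s b = ∃ λ t → ∃ λ s' → runIS t X 0 s ≡ just s' × outR s' ≡ b

-- X computes f : {0,1}^n → {0,1}.  Registers whose initial content is
-- not prescribed by the definition (in:i for i ∉ {1..n}, aux:j for j ∉ {1..k})
-- are allowed arbitrary initial content.
Computes : (n : ℕ) → (Vec Bool n → Bool) → InstrSeq → Set
Computes n f X = Σ ℕ λ k → (bs : Vec Bool n) → (ι α : ℕ → Bool) →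
  ((i : Fin n) → ι (suc (toℕ i)) ≡ lookup bs i) →
  ((j : ℕ) → 1 ≤ j → j ≤ k → α j ≡ false) →
  TerminatesWithOut X (regs ι false α) (f bs)

tstnz : (n : ℕ) → Vec Bool n → Bool
tstnz .zero    []ᵥ        = false
tstnz .(suc _) (b ∷ᵥ bs) = b ∨ tstnz _ bs

L : ℕ → ℕ
L n = if n % 2 ≡ᵇ 0 then (3 * n) / 2 + 1 else (3 * (n + 1)) / 2

readReg : PrimInstr → Maybe ℕ
readReg (pos (inGet i)) = just i
readReg (neg (inGet i)) = just i
readReg _               = nothing

reads : InstrSeq → List ℕ
reads = mapMaybe readReg

data ZInstr : PrimInstr → Set where
  zpos : ∀ i → ZInstr (pos (inGet i))
  zneg : ∀ i → ZInstr (neg (inGet i))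
  zjmp : ∀ l → ZInstr (jmp (suc l))

Good : InstrSeq → Set
Good X = Σ InstrSeq λ Z → All ZInstr Z × (X ≡ Z ++ (plain (outSet true) ∷ term ∷ []))

VeryGood : InstrSeq → Set
VeryGood X = Good X × Unique (reads X)

IregsIs1toN : InstrSeq → ℕ → Set
IregsIs1toN X n = (i : ℕ) → (i ∈ reads X) ⇔ (1 ≤ i × i ≤ n)

data RAMInstr : Set where
  load  : ℕ → ℤ → RAMInstr
  add   : ℕ → ℕ → ℕ → RAMInstr
  sub   : ℕ → ℕ → ℕ → RAMInstr
  ldind : ℕ → ℕ → RAMInstr
  stind : ℕ → ℕ → RAMInstr
  tra   : ℕ → ℕ → RAMInstr
  read  : ℕ → RAMInstr
  print : ℕ → RAMInstr

RAMProg : Set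
RAMProg = List RAMInstr

record Config : Set where
  constructor config
  field
    pc   : ℕ
    reg  : ℕ → ℤ
    inp  : List ℤ
    outp : List ℤ
open Config public

data Step : Set where
  halted : List ℤ → Step
  next   : Config → Step
  fault  : Step

updZ : (ℕ → ℤ) → ℕ → ℤ → ℕ → ℤ
updZ f i v j = if j ≡ᵇ i then v else f j

nthR : RAMProg → ℕ → Maybe RAMInstr
nthR []       _       = nothing
nthR (u ∷ _)  zero    = just u
nthR (_ ∷ us) (suc p) = nthR us p

stepRAM : RAMProg → Config → Step
stepRAM P (config p r i o) with nthR P p
... | nothing = halted o
... | just (load k v)  = next (config (suc p) (updZ r k v) i o)
... | just (add k a b) = next (config (suc p) (updZ r k (r a +ℤ r b)) i o)
... | just (sub k a b) = next (config (suc p) (updZ r k (r a - r b)) i o)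
... | just (ldind k a) with r a
...   | + addr   = next (config (suc p) (updZ r k (r addr)) i o)
...   | -[1+ _ ] = fault
stepRAM P (config p r i o) | just (stind k a) with r k
...   | + addr   = next (config (suc p) (updZ r addr (r a)) i o)
...   | -[1+ _ ] = fault
stepRAM P (config p r i o) | just (tra m j) with r j
...   | + (suc _) = next (config m r i o)
...   | + zero    = next (config (suc p) r i o)
...   | -[1+ _ ]  = next (config (suc p) r i o)
stepRAM P (config p r [] o)      | just (read k) = fault
stepRAM P (config p r (v ∷ i) o) | just (read k) = next (config (suc p) (updZ r k v) i o)
stepRAM P (config p r i o) | just (print k) = next (config (suc p) r i (o ++ (r k ∷ [])))

-- run for at most t steps (each step costs 1: uniform cost criterion);
-- just o = halted within t steps with output o
runRAM : ℕ → RAMProg → Config → Maybe (List ℤ)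
runRAM zero    P c = nothing
runRAM (suc t) P c with stepRAM P c
... | halted o = just o
... | next c'  = runRAM t P c'
... | fault    = nothing

initConfig : List ℤ → Config
initConfig inp = config 0 (λ _ → + 0) inp []

basicCode : BasicInstr → ℕ
basicCode (inGet _)        = 0
basicCode (outSet false)   = 1
basicCode (outSet true)    = 2
basicCode (auxGet _)       = 3
basicCode (auxSet _ false) = 4
basicCode (auxSet _ true)  = 5

basicParam : BasicInstr → ℤ
basicParam (inGet i)    = + i
basicParam (outSet _)   = -[1+ 0 ]
basicParam (auxGet i)   = + i
basicParam (auxSet i _) = + i

encodeInstr : PrimInstr → List ℤ
encodeInstr (plain a) = + basicCode a ∷ basicParam a ∷ []
encodeInstr (pos a)   = + (6 + basicCode a) ∷ basicParam a ∷ []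
encodeInstr (neg a)   = + (12 + basicCode a) ∷ basicParam a ∷ []
encodeInstr (jmp l)   = + 18 ∷ + l ∷ []
encodeInstr term      = + 19 ∷ -[1+ 0 ] ∷ []

encodeInput : ℕ → ℕ → InstrSeq → List ℤ
encodeInput n m X = + n ∷ + m ∷ concatMap encodeInstr X

boolToℤ : Bool → ℤ
boolToℤ true  = + 1
boolToℤ false = + 0

module Submission where

-- Reading a good sequence from right to left one computes, for every
-- suffix, the number of reply paths that do not end in out.set:1;!, the
-- number whose output differs from the disjunction of the replies met, and
-- the number of reads on the path all of whose replies are false.  As each
-- register is read by a single instruction, a very good X computes tstnz
-- exactly when no path is wrong and the all-false path reads every
-- register: otherwise the inputs read along a bad path, or skipped by the
-- all-false path, can be chosen so that X errs.  A random access machine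
-- copies X into a table and fills in these three numbers backwards, in a
-- constant number of steps per instruction, hence in time O(L n + m),
-- which is O(n (n + m)).

open import Defs
open import Data.Nat using (ℕ; _+_; _*_; _≤_)
open import Data.Bool using (Bool; true)
open import Data.List using (List; []; _∷_)
open import Data.Maybe using (just)
open import Data.Product using (∃; _×_)
open import Function.Bundles using (_⇔_)
open import Relation.Binary.PropositionalEquality using (_≡_)

open import Data.Nat using (zero; suc; _∸_; _<_; _≟_; z≤n; s≤s; s≤s⁻¹; _≡ᵇ_; _<ᵇ_; _≤ᵇ_)
open import Data.Nat.Tactic.RingSolver using (solve-∀)
open import Data.Nat.DivMod using (_/_; m/n≤m; _%_; [m+kn]%n≡m%n; m<n⇒m%n≡m)
open import Data.Nat.Properties
  using (≤-refl; ≤-trans; <⇒≤; <⇒≱; suc-injective; m+n≡0⇒m≡0; m+n≡0⇒n≡0; +-∸-assoc;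
         *-cancelʳ-≡; +-cancelˡ-≡; +-monoʳ-≤; +-monoˡ-≤; +-suc; m≤m+n; n≤1+n; <-cmp; ≤-reflexive;
         m≤n+m; m≤n*m; *-monoˡ-≤; *-monoʳ-≤; *-distribˡ-+; module ≤-Reasoning; m≤n⇒m<n∨m≡n; <⇒≢;
         <ᵇ⇒<; ≤ᵇ⇒≤; ≡ᵇ⇒≡; ≡⇒≡ᵇ)
open import Data.Bool using (false; if_then_else_; _∨_; T)
open import Data.Bool.Properties using (⇔→≡; T-≡)
open import Data.Bool.ListAction using (any)
open import Data.Empty using (⊥-elim)
open import Data.Integer using (ℤ; +_; -[1+_]; -_; _-_; NonPositive; nonPos0; nonPos) renaming (_+_ to _+ℤ_)
open import Data.Integer.Properties using (m-n≡m⊖n; ⊖-≥; ⊖-≤)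
open import Data.Fin using (toℕ; fromℕ<) renaming (zero to fzero; suc to fsuc)
open import Data.Fin.Properties using (toℕ-fromℕ<; toℕ<n)
open import Data.List using (_++_; take; drop; length; concatMap)
open import Data.List.Properties using (mapMaybe-++; take++drop≡id; length-++; length-++-≤ʳ; drop-all; drop-drop)
open import Data.List.Membership.Propositional using (_∈_; _∉_; find; lose)
open import Data.List.Membership.Propositional.Properties using (∈-++⁺ˡ; ∈-++⁺ʳ)
open import Data.List.Membership.DecPropositional _≟_ using (_∈?_)
open import Data.List.Relation.Unary.All using (All; []; _∷_)
open import Data.List.Relation.Unary.All.Properties using (All¬⇒¬Any)
open import Data.List.Relation.Unary.AllPairs using (_∷_)
open import Data.List.Relation.Unary.Any using (here; there)
open import Data.List.Relation.Unary.Any.Properties using (any⁺; any⁻)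
open import Data.List.Relation.Unary.Unique.Propositional using (Unique)
open import Data.Maybe using (nothing)
open import Data.Product using (_,_; proj₁; proj₂; ∃₂)
open import Data.Sum using (inj₁; inj₂)
open import Data.Vec using (Vec; lookup; tabulate) renaming (_∷_ to _∷ᵥ_)
open import Data.Vec.Properties using (lookup∘tabulate)
open import Function.Base using (_∘_; const)
open import Function.Bundles using (mk⇔; Equivalence)
open import Function.Properties.Equivalence using () renaming (trans to ⇔-trans)
open import Relation.Binary.PropositionalEquality using (refl; sym; trans; cong; cong₂; subst; _≢_; module ≡-Reasoning)
open import Relation.Nullary using (¬_; Dec; yes; no; does; contradiction)
open import Relation.Nullary.Decidable using (_×-dec_; dec-true; dec-false)
open import Relation.Binary.Definitions using (tri<; tri≈; tri>)

open Equivalence using (to; from)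

runIS-[] : ∀ t p s → runIS t [] p s ≡ nothing
runIS-[] zero    p s = refl
runIS-[] (suc t) p s = refl

runIS-∷ : ∀ t u S p s → runIS t (u ∷ S) (suc p) s ≡ runIS t S p s
runIS-∷ zero    u S p s = refl
runIS-∷ (suc t) u S p s with nth S p
... | nothing        = refl
... | just term      = refl
... | just (jmp l)   = runIS-∷ t u S (p + l) s
... | just (plain a) = runIS-∷ t u S (suc p) (proj₂ (execBasic a s))
... | just (pos a) with proj₁ (execBasic a s)
...   | true  = runIS-∷ t u S (suc p) (proj₂ (execBasic a s))
...   | false = runIS-∷ t u S (suc (suc p)) (proj₂ (execBasic a s))
runIS-∷ (suc t) u S p s | just (neg a) with proj₁ (execBasic a s)
...   | true  = runIS-∷ t u S (suc (suc p)) (proj₂ (execBasic a s))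
...   | false = runIS-∷ t u S (suc p) (proj₂ (execBasic a s))

runIS-drop : ∀ t k S s → runIS t S k s ≡ runIS t (drop k S) 0 s
runIS-drop t zero    S        s = refl
runIS-drop t (suc k) []       s = trans (runIS-[] t (suc k) s) (sym (runIS-[] t 0 s))
runIS-drop t (suc k) (u ∷ S) s = trans (runIS-∷ t u S k s) (runIS-drop t k S s)

runIS-functional : ∀ t t' S p s {s₁ s₂} →
                   runIS t S p s ≡ just s₁ → runIS t' S p s ≡ just s₂ → s₁ ≡ s₂
runIS-functional zero    t'       S p s ()   _
runIS-functional (suc t) zero     S p s _    ()
runIS-functional (suc t) (suc t') S p s r₁ r₂ with nth S p
runIS-functional (suc t) (suc t') S p s ()   _    | nothing
runIS-functional (suc t) (suc t') S p s refl refl | just term = refl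
... | just (jmp l)   = runIS-functional t t' S (p + l) s r₁ r₂
... | just (plain a) = runIS-functional t t' S (suc p) _ r₁ r₂
... | just (pos a) with proj₁ (execBasic a s)
...   | true  = runIS-functional t t' S (suc p) _ r₁ r₂
...   | false = runIS-functional t t' S (suc (suc p)) _ r₁ r₂
runIS-functional (suc t) (suc t') S p s r₁ r₂ | just (neg a) with proj₁ (execBasic a s)
...   | true  = runIS-functional t t' S (suc (suc p)) _ r₁ r₂
...   | false = runIS-functional t t' S (suc p) _ r₁ r₂

TerminatesWithOut-functional : ∀ {S s b b'} →
  TerminatesWithOut S s b → TerminatesWithOut S s b' → b ≡ b'
TerminatesWithOut-functional (t , _ , r₁ , o₁) (t' , _ , r₂ , o₂) =
  trans (sym o₁) (trans (cong outR (runIS-functional t t' _ 0 _ r₁ r₂)) o₂)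

¬TerminatesWithOut-[] : ∀ {s b} → ¬ TerminatesWithOut [] s b
¬TerminatesWithOut-[] (zero  , _ , () , _)
¬TerminatesWithOut-[] (suc _ , _ , () , _)

TerminatesWithOut-step : ∀ {S S' s b} → (∀ t → runIS (suc t) S 0 s ≡ runIS t S' 0 s) →
                         TerminatesWithOut S s b ⇔ TerminatesWithOut S' s b
TerminatesWithOut-step step = mk⇔
  (λ { (zero , _ , () , _) ; (suc t , s' , r , o) → t , s' , trans (sym (step t)) r , o })
  (λ { (t , s' , r , o) → suc t , s' , trans (step t) r , o })

module _ {ι α : ℕ → Bool} {b o : Bool} where

  TerminatesWithOut-jmp : ∀ l us → TerminatesWithOut (jmp (suc l) ∷ us) (regs ι b α) o
                 ⇔ TerminatesWithOut (drop l us) (regs ι b α) o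
  TerminatesWithOut-jmp l us = TerminatesWithOut-step λ t → runIS-drop t (suc l) (jmp (suc l) ∷ us) _

  TerminatesWithOut-pos : ∀ {r} i us → ι i ≡ r →
          TerminatesWithOut (pos (inGet i) ∷ us) (regs ι b α) o
          ⇔ TerminatesWithOut (if r then us else drop 1 us) (regs ι b α) o
  TerminatesWithOut-pos i us refl = TerminatesWithOut-step step
    where
    step : ∀ t → runIS (suc t) (pos (inGet i) ∷ us) 0 (regs ι b α)
               ≡ runIS t (if ι i then us else drop 1 us) 0 (regs ι b α)
    step t with ι i
    ... | true  = runIS-∷ t _ us 0 _
    ... | false = runIS-drop t 2 (pos (inGet i) ∷ us) _

  TerminatesWithOut-neg : ∀ {r} i us → ι i ≡ r →
          TerminatesWithOut (neg (inGet i) ∷ us) (regs ι b α) o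
          ⇔ TerminatesWithOut (if r then drop 1 us else us) (regs ι b α) o
  TerminatesWithOut-neg i us refl = TerminatesWithOut-step step
    where
    step : ∀ t → runIS (suc t) (neg (inGet i) ∷ us) 0 (regs ι b α)
               ≡ runIS t (if ι i then drop 1 us else us) 0 (regs ι b α)
    step t with ι i
    ... | true  = runIS-drop t 2 (neg (inGet i) ∷ us) _
    ... | false = runIS-∷ t _ us 0 _

TerminatesWithOut-reply : ∀ {S s} {ι : ℕ → Bool} {i R r} → ι i ≡ r →
  TerminatesWithOut S s (any ι (i ∷ R)) → TerminatesWithOut S s (r ∨ any ι R)
TerminatesWithOut-reply {S} {s} {ι} {R = R} ιi = subst (TerminatesWithOut S s) (cong (_∨ any ι R) ιi)

-- Summaries of good suffixes

-- A path through a sequence is determined by the replies to its tests.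
-- unsetPaths counts the paths that do not end in out.set:1;!, wrongPaths
-- those whose output differs from the disjunction of the replies on the
-- path, and allFalseReads is the number of reads on the path all of whose
-- replies are false.  Running off the end is an unset and a wrong path.
record Summary : Set where
  constructor ⟨_,_,_⟩
  field
    unsetPaths wrongPaths allFalseReads : ℕ
open Summary

runOff : Summary
runOff = ⟨ 1 , 1 , 0 ⟩

headOr : ∀ {A : Set} → A → List A → A
headOr d []      = d
headOr _ (x ∷ _) = x

-- After a true reply the disjunction is true, so there the wrong paths are
-- the unset ones.
testSummary : (onTrue onFalse : Summary) → Summary
testSummary t f =
  ⟨ unsetPaths t + unsetPaths f , unsetPaths t + wrongPaths f , suc (allFalseReads f) ⟩

summarize : PrimInstr → List Summary → Summary
summarize term                  _  = ⟨ 1 , 0 , 0 ⟩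
summarize (plain (outSet true)) _  = ⟨ 0 , 1 , 0 ⟩
summarize (jmp (suc l))         ss = headOr runOff (drop l ss)
summarize (pos (inGet i))       ss = testSummary (headOr runOff ss) (headOr runOff (drop 1 ss))
summarize (neg (inGet i))       ss = testSummary (headOr runOff (drop 1 ss)) (headOr runOff ss)
summarize _                     _  = runOff

summaries : InstrSeq → List Summary
summaries []       = []
summaries (u ∷ us) = summarize u (summaries us) ∷ summaries us

summary : InstrSeq → Summary
summary S = headOr runOff (summaries S)

drop-summaries : ∀ k S → drop k (summaries S) ≡ summaries (drop k S)
drop-summaries zero    S        = refl
drop-summaries (suc k) []       = refl
drop-summaries (suc k) (u ∷ S) = drop-summaries k S

summary-jmp : ∀ l us → summary (jmp (suc l) ∷ us) ≡ summary (drop l us)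
summary-jmp l us = cong (headOr runOff) (drop-summaries l us)

summary-pos : ∀ i us → summary (pos (inGet i) ∷ us) ≡ testSummary (summary us) (summary (drop 1 us))
summary-pos i us = cong (testSummary (summary us) ∘ headOr runOff) (drop-summaries 1 us)

summary-neg : ∀ i us → summary (neg (inGet i) ∷ us) ≡ testSummary (summary (drop 1 us)) (summary us)
summary-neg i us = cong (λ ss → testSummary (headOr runOff ss) (summary us)) (drop-summaries 1 us)

readCount : InstrSeq → ℕ
readCount S = length (reads S)

Accepting : InstrSeq → Set
Accepting S = wrongPaths (summary S) ≡ 0 × allFalseReads (summary S) ≡ readCount S

accepting? : ∀ S → Dec (Accepting S)
accepting? S = (wrongPaths (summary S) ≟ 0) ×-dec (allFalseReads (summary S) ≟ readCount S)

data GoodSeq : InstrSeq → Set where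
  set1 : GoodSeq (plain (outSet true) ∷ term ∷ [])
  _◂_  : ∀ {u us} → ZInstr u → GoodSeq us → GoodSeq (u ∷ us)

data GoodSuffix : InstrSeq → Set where
  empty : GoodSuffix []
  halt  : GoodSuffix (term ∷ [])
  good  : ∀ {S} → GoodSeq S → GoodSuffix S

GoodSuffix-drop : ∀ k {S} → GoodSuffix S → GoodSuffix (drop k S)
GoodSuffix-drop zero    g                = g
GoodSuffix-drop (suc k) empty            = empty
GoodSuffix-drop (suc k) halt             = GoodSuffix-drop k empty
GoodSuffix-drop (suc k) (good set1)      = GoodSuffix-drop k halt
GoodSuffix-drop (suc k) (good (_ ◂ g))   = GoodSuffix-drop k (good g)

Good⇒GoodSeq : ∀ {X} → Good X → GoodSeq X
Good⇒GoodSeq (Z , zs , refl) = go zs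
  where
  go : ∀ {Z} → All ZInstr Z → GoodSeq (Z ++ plain (outSet true) ∷ term ∷ [])
  go []       = set1
  go (z ∷ zs) = z ◂ go zs

-- Jumps lead to arbitrary later suffixes, so we induct over all suffixes at once.
suffix-ind : (P : InstrSeq → Set) → P [] → (∀ u us → (∀ k → P (drop k us)) → P (u ∷ us)) →
             ∀ S → P S
suffix-ind P base step S = suffixes S 0
  where
  suffixes : ∀ S k → P (drop k S)
  suffixes []       zero    = base
  suffixes []       (suc k) = base
  suffixes (u ∷ us) zero    = step u us (suffixes us)
  suffixes (u ∷ us) (suc k) = suffixes us k

reads-take-drop : ∀ k S → reads S ≡ reads (take k S) ++ reads (drop k S)
reads-take-drop k S = trans (cong reads (sym (take++drop≡id k S))) (mapMaybe-++ readReg (take k S) (drop k S))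

∈-reads-drop : ∀ k S {x} → x ∈ reads (drop k S) → x ∈ reads S
∈-reads-drop k S x∈ = subst (_ ∈_) (sym (reads-take-drop k S)) (∈-++⁺ʳ (reads (take k S)) x∈)

readCount-drop : ∀ k S → readCount (drop k S) ≤ readCount S
readCount-drop k S = subst (λ R → readCount (drop k S) ≤ length R) (sym (reads-take-drop k S))
                           (length-++-≤ʳ (reads (drop k S)) {reads (take k S)})

reads-drop-≡ : ∀ k S → readCount S ≤ readCount (drop k S) → reads (drop k S) ≡ reads S
reads-drop-≡ k S le with reads (take k S) | reads-take-drop k S
... | []    | eq = sym eq
... | x ∷ P | eq = contradiction (subst (λ R → length R ≤ readCount (drop k S)) eq le)
                                 (<⇒≱ (s≤s (length-++-≤ʳ (reads (drop k S)) {P})))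

Unique-head : ∀ {i : ℕ} {R} → Unique (i ∷ R) → i ∉ R
Unique-head (i≢R ∷ _) = All¬⇒¬Any i≢R

Unique-tail : ∀ {i : ℕ} {R} → Unique (i ∷ R) → Unique R
Unique-tail (_ ∷ u) = u

Unique-++⁻ʳ : ∀ (Q : List ℕ) {R} → Unique (Q ++ R) → Unique R
Unique-++⁻ʳ []      u       = u
Unique-++⁻ʳ (_ ∷ Q) (_ ∷ u) = Unique-++⁻ʳ Q u

Unique-++-disjoint : ∀ (Q : List ℕ) {R x} → Unique (Q ++ R) → x ∈ Q → x ∉ R
Unique-++-disjoint (_ ∷ Q) u       (here refl) = Unique-head u ∘ ∈-++⁺ʳ Q
Unique-++-disjoint (_ ∷ Q) (_ ∷ u) (there x∈)  = Unique-++-disjoint Q u x∈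

Unique-reads-drop : ∀ k S → Unique (reads S) → Unique (reads (drop k S))
Unique-reads-drop k S u = Unique-++⁻ʳ (reads (take k S)) (subst Unique (reads-take-drop k S) u)

allFalseReads≤readCount : ∀ S → GoodSuffix S → allFalseReads (summary S) ≤ readCount S
allFalseReads≤readCount = suffix-ind P (λ _ → z≤n) step
  where
  P : InstrSeq → Set
  P S = GoodSuffix S → allFalseReads (summary S) ≤ readCount S
  step : ∀ u us → (∀ k → P (drop k us)) → P (u ∷ us)
  step _ _  ih halt        = z≤n
  step _ _  ih (good set1) = z≤n
  step _ us ih (good (zjmp l ◂ g)) rewrite drop-summaries l us =
    ≤-trans (ih l (GoodSuffix-drop l (good g))) (readCount-drop l us)
  step _ us ih (good (zpos i ◂ g)) rewrite drop-summaries 1 us =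
    s≤s (≤-trans (ih 1 (GoodSuffix-drop 1 (good g))) (readCount-drop 1 us))
  step _ us ih (good (zneg i ◂ g)) = s≤s (ih 0 (good g))

any-++ : ∀ (ι : ℕ → Bool) Q R → any ι (Q ++ R) ≡ (any ι Q ∨ any ι R)
any-++ ι []      R = refl
any-++ ι (x ∷ Q) R with ι x
... | true  = refl
... | false = any-++ ι Q R

any-false : ∀ {ι : ℕ → Bool} (R : List ℕ) → (∀ {x} → x ∈ R → ι x ≡ false) → any ι R ≡ false
any-false []      _ = refl
any-false (x ∷ R) h rewrite h (here refl) = any-false R (h ∘ there)

any≡true⇔ : ∀ {ι : ℕ → Bool} {R} → any ι R ≡ true ⇔ ∃ λ x → x ∈ R × ι x ≡ true
any≡true⇔ {ι} {R} = mk⇔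
  (λ e → let x , x∈ , t = find (any⁻ ι R (from T-≡ e)) in x , x∈ , to T-≡ t)
  (λ (x , x∈ , e) → to T-≡ (any⁺ ι (lose x∈ (from T-≡ e))))

-- Choosing the inputs read by a sequence

ChoosableOn : List ℕ → ((ℕ → Bool) → Set) → Set
ChoosableOn R P =
  ∀ (ι₀ : ℕ → Bool) → ∃ λ (ι : ℕ → Bool) → (∀ x → x ∉ R → ι x ≡ ι₀ x) × P ι

override : List ℕ → (ℕ → Bool) → (ℕ → Bool) → ℕ → Bool
override R f ι x = if does (x ∈? R) then f x else ι x

override-∈ : ∀ R f ι {x} → x ∈ R → override R f ι x ≡ f x
override-∈ R f ι {x} x∈ with x ∈? R
... | yes _  = refl
... | no x∉ = contradiction x∈ x∉

override-∉ : ∀ R f ι {x} → x ∉ R → override R f ι x ≡ ι x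
override-∉ R f ι {x} x∉ with x ∈? R
... | yes x∈ = contradiction x∈ x∉
... | no _   = refl

ChoosableOn-intro : ∀ {R P} → (∀ ι → P ι) → ChoosableOn R P
ChoosableOn-intro p ι₀ = ι₀ , (λ _ _ → refl) , p ι₀

ChoosableOn-map : ∀ {R : List ℕ} {P Q : (ℕ → Bool) → Set} →
                  (∀ {ι} → P ι → Q ι) → ChoosableOn R P → ChoosableOn R Q
ChoosableOn-map f c ι₀ with c ι₀
... | ι , agree , p = ι , agree , f p

ChoosableOn-⊆ : ∀ {R R' : List ℕ} {P} → (∀ {x} → x ∈ R → x ∈ R') → ChoosableOn R P → ChoosableOn R' P
ChoosableOn-⊆ R⊆R' c ι₀ with c ι₀
... | ι , agree , p = ι , (λ x x∉ → agree x (x∉ ∘ R⊆R')) , p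

ChoosableOn-values : ∀ R f → ChoosableOn R (λ ι → ∀ {x} → x ∈ R → ι x ≡ f x)
ChoosableOn-values R f ι₀ = override R f ι₀ , (λ _ → override-∉ R f ι₀) , override-∈ R f ι₀

ChoosableOn-++ : ∀ (Q : List ℕ) {R P} f → (∀ {x} → x ∈ Q → x ∉ R) → ChoosableOn R P →
                 ChoosableOn (Q ++ R) (λ ι → (∀ {x} → x ∈ Q → ι x ≡ f x) × P ι)
ChoosableOn-++ Q f disjoint c ι₀ with c (override Q f ι₀)
... | ι , agree , p =
  ι , (λ x x∉ → trans (agree x (x∉ ∘ ∈-++⁺ʳ Q)) (override-∉ Q f ι₀ (x∉ ∘ ∈-++⁺ˡ))) ,
      (λ x∈ → trans (agree _ (disjoint x∈)) (override-∈ Q f ι₀ x∈)) , p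

ChoosableOn-∷ : ∀ {i : ℕ} {R P} r → i ∉ R → ChoosableOn R P →
                ChoosableOn (i ∷ R) (λ ι → ι i ≡ r × P ι)
ChoosableOn-∷ r i∉R c =
  ChoosableOn-map (λ (h , p) → h (here refl) , p) (ChoosableOn-++ (_ ∷ []) (const r) (λ { (here refl) → i∉R }) c)

unsetPaths≡0⇒sets-out : ∀ S → GoodSuffix S → unsetPaths (summary S) ≡ 0 →
                        ∀ ι α → TerminatesWithOut S (regs ι false α) true
unsetPaths≡0⇒sets-out = suffix-ind P (λ _ ()) step
  where
  P : InstrSeq → Set
  P S = GoodSuffix S → unsetPaths (summary S) ≡ 0 →
        ∀ ι α → TerminatesWithOut S (regs ι false α) true
  step : ∀ u us → (∀ k → P (drop k us)) → P (u ∷ us)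
  step _ _  ih halt ()
  step _ _  ih (good set1) _ ι α = 2 , _ , refl , refl
  step _ us ih (good (zjmp l ◂ g)) u≡0 ι α rewrite drop-summaries l us =
    from (TerminatesWithOut-jmp l us) (ih l (GoodSuffix-drop l (good g)) u≡0 ι α)
  step _ us ih (good (zpos i ◂ g)) u≡0 ι α rewrite drop-summaries 1 us with ι i in ιi
  ... | true  = from (TerminatesWithOut-pos i us ιi) (ih 0 (good g) (m+n≡0⇒m≡0 _ u≡0) ι α)
  ... | false = from (TerminatesWithOut-pos i us ιi) (ih 1 (GoodSuffix-drop 1 (good g)) (m+n≡0⇒n≡0 _ u≡0) ι α)
  step _ us ih (good (zneg i ◂ g)) u≡0 ι α rewrite drop-summaries 1 us with ι i in ιi
  ... | true  = from (TerminatesWithOut-neg i us ιi) (ih 1 (GoodSuffix-drop 1 (good g)) (m+n≡0⇒m≡0 _ u≡0) ι α)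
  ... | false = from (TerminatesWithOut-neg i us ιi) (ih 0 (good g) (m+n≡0⇒n≡0 _ u≡0) ι α)

-- allFalseReads never exceeds readCount, so a suffix whose all-false path
-- reads as often as S skipped none of the reads of S.
accepting-drop : ∀ k S → GoodSuffix (drop k S) →
  wrongPaths (summary (drop k S)) ≡ 0 → allFalseReads (summary (drop k S)) ≡ readCount S →
  Accepting (drop k S) × reads (drop k S) ≡ reads S
accepting-drop k S g w≡0 f≡ = (w≡0 , trans f≡ (sym (cong length same))) , same
  where
  same : reads (drop k S) ≡ reads S
  same = reads-drop-≡ k S (subst (_≤ readCount (drop k S)) f≡ (allFalseReads≤readCount (drop k S) g))

accepting⇒outputs-any : ∀ S → GoodSuffix S → Accepting S →
                        ∀ ι α → TerminatesWithOut S (regs ι false α) (any ι (reads S))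
accepting⇒outputs-any = suffix-ind P (λ _ ()) step
  where
  P : InstrSeq → Set
  P S = GoodSuffix S → Accepting S →
        ∀ ι α → TerminatesWithOut S (regs ι false α) (any ι (reads S))
  step : ∀ u us → (∀ k → P (drop k us)) → P (u ∷ us)
  step _ _  ih halt _ ι α = 1 , _ , refl , refl
  step _ _  ih (good set1) (() , _)
  step _ us ih (good (zjmp l ◂ g)) (w≡0 , f≡) ι α rewrite drop-summaries l us
    with acc , same ← accepting-drop l us (GoodSuffix-drop l (good g)) w≡0 f≡ =
    from (TerminatesWithOut-jmp l us)
      (subst (TerminatesWithOut (drop l us) (regs ι false α) ∘ any ι) same (ih l (GoodSuffix-drop l (good g)) acc ι α))
  step _ us ih (good (zpos i ◂ g)) (w≡0 , f≡) ι α rewrite drop-summaries 1 us with ι i in ιi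
  ... | true  = from (TerminatesWithOut-pos i us ιi) (unsetPaths≡0⇒sets-out us (good g) (m+n≡0⇒m≡0 _ w≡0) ι α)
  ... | false
    with acc , same ← accepting-drop 1 us (GoodSuffix-drop 1 (good g)) (m+n≡0⇒n≡0 _ w≡0) (suc-injective f≡) =
    from (TerminatesWithOut-pos i us ιi)
      (subst (TerminatesWithOut (drop 1 us) (regs ι false α) ∘ any ι) same (ih 1 (GoodSuffix-drop 1 (good g)) acc ι α))
  step _ us ih (good (zneg i ◂ g)) (w≡0 , f≡) ι α rewrite drop-summaries 1 us with ι i in ιi
  ... | true  = from (TerminatesWithOut-neg i us ιi)
                  (unsetPaths≡0⇒sets-out (drop 1 us) (GoodSuffix-drop 1 (good g)) (m+n≡0⇒m≡0 _ w≡0) ι α)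
  ... | false = from (TerminatesWithOut-neg i us ιi) (ih 0 (good g) (m+n≡0⇒n≡0 _ w≡0 , suc-injective f≡) ι α)

unsetPaths≢0⇒avoids-set : ∀ S → GoodSuffix S → Unique (reads S) → unsetPaths (summary S) ≢ 0 →
  ChoosableOn (reads S) (λ ι → ∀ α → ¬ TerminatesWithOut S (regs ι false α) true)
unsetPaths≢0⇒avoids-set = suffix-ind P (λ _ _ _ → ChoosableOn-intro λ _ _ → ¬TerminatesWithOut-[]) step
  where
  P : InstrSeq → Set
  P S = GoodSuffix S → Unique (reads S) → unsetPaths (summary S) ≢ 0 →
        ChoosableOn (reads S) (λ ι → ∀ α → ¬ TerminatesWithOut S (regs ι false α) true)
  step : ∀ u us → (∀ k → P (drop k us)) → P (u ∷ us)
  step _ _  ih halt _ _ = ChoosableOn-intro λ { _ _ (zero , _ , () , _) ; _ _ (suc _ , _ , refl , ()) }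
  step _ _  ih (good set1) _ u≢0 = contradiction refl u≢0
  step _ us ih (good (zjmp l ◂ g)) u u≢0 rewrite drop-summaries l us =
    ChoosableOn-⊆ (∈-reads-drop l us) (ChoosableOn-map (λ h α → h α ∘ to (TerminatesWithOut-jmp l us))
      (ih l (GoodSuffix-drop l (good g)) (Unique-reads-drop l us u) u≢0))
  step _ us ih (good (zpos i ◂ g)) u u≢0 rewrite drop-summaries 1 us with unsetPaths (summary us) ≟ 0
  ... | no  n≢0 = ChoosableOn-map (λ (ιi , h) α → h α ∘ to (TerminatesWithOut-pos i us ιi))
                    (ChoosableOn-∷ true (Unique-head u) (ih 0 (good g) (Unique-tail u) n≢0))
  ... | yes n≡0 = ChoosableOn-map (λ (ιi , h) α → h α ∘ to (TerminatesWithOut-pos i us ιi))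
                    (ChoosableOn-∷ false (Unique-head u) (ChoosableOn-⊆ (∈-reads-drop 1 us)
                      (ih 1 (GoodSuffix-drop 1 (good g)) (Unique-reads-drop 1 us (Unique-tail u))
                          (λ s≡0 → u≢0 (cong₂ _+_ n≡0 s≡0)))))
  step _ us ih (good (zneg i ◂ g)) u u≢0 rewrite drop-summaries 1 us with unsetPaths (summary (drop 1 us)) ≟ 0
  ... | no  s≢0 = ChoosableOn-map (λ (ιi , h) α → h α ∘ to (TerminatesWithOut-neg i us ιi))
                    (ChoosableOn-∷ true (Unique-head u) (ChoosableOn-⊆ (∈-reads-drop 1 us)
                      (ih 1 (GoodSuffix-drop 1 (good g)) (Unique-reads-drop 1 us (Unique-tail u)) s≢0)))
  ... | yes s≡0 = ChoosableOn-map (λ (ιi , h) α → h α ∘ to (TerminatesWithOut-neg i us ιi))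
                    (ChoosableOn-∷ false (Unique-head u)
                      (ih 0 (good g) (Unique-tail u) (λ n≡0 → u≢0 (cong₂ _+_ s≡0 n≡0))))

Miscomputable : InstrSeq → Set
Miscomputable S = ChoosableOn (reads S) (λ ι → ∀ α → ¬ TerminatesWithOut S (regs ι false α) (any ι (reads S)))

-- Reaching T skipped the reads Q.  If T is accepting, setting some register
-- of Q makes the disjunction true while T still outputs false.
miscomputable-skipping : ∀ Q {T} → GoodSuffix T → Unique (Q ++ reads T) →
  (Unique (reads T) → ¬ Accepting T → Miscomputable T) →
  ¬ (wrongPaths (summary T) ≡ 0 × allFalseReads (summary T) ≡ length Q + readCount T) →
  ChoosableOn (Q ++ reads T) (λ ι → ∀ α → ¬ TerminatesWithOut T (regs ι false α) (any ι (Q ++ reads T)))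
miscomputable-skipping Q {T} g u ih ¬acc with accepting? T
... | no ¬accT =
  ChoosableOn-map (λ {ι} (Q-false , h) α → h α ∘ subst (TerminatesWithOut T (regs ι false α))
                     (trans (any-++ ι Q (reads T)) (cong (_∨ any ι (reads T)) (any-false Q Q-false))))
    (ChoosableOn-++ Q (const false) (Unique-++-disjoint Q u) (ih (Unique-++⁻ʳ Q u) ¬accT))
miscomputable-skipping []      g u ih ¬acc | yes acc = contradiction acc ¬acc
miscomputable-skipping (j ∷ Q) {T} g u ih ¬acc | yes acc =
  ChoosableOn-map (λ {ι} (Q-true , T-false) α out →
                     contradiction (trans (sym (any-false (reads T) T-false))
                                     (trans (TerminatesWithOut-functional (accepting⇒outputs-any T g acc ι α) out)
                                            (cong (_∨ any ι (Q ++ reads T)) (Q-true (here refl)))))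
                                   λ ())
    (ChoosableOn-++ (j ∷ Q) (const true) (Unique-++-disjoint (j ∷ Q) u) (ChoosableOn-values (reads T) (const false)))

miscomputable-drop : ∀ k S → GoodSuffix (drop k S) → Unique (reads S) →
  (Unique (reads (drop k S)) → ¬ Accepting (drop k S) → Miscomputable (drop k S)) →
  ¬ (wrongPaths (summary (drop k S)) ≡ 0 × allFalseReads (summary (drop k S)) ≡ readCount S) →
  ChoosableOn (reads S) (λ ι → ∀ α → ¬ TerminatesWithOut (drop k S) (regs ι false α) (any ι (reads S)))
miscomputable-drop k S g u ih ¬acc =
  subst (λ R → ChoosableOn R (λ ι → ∀ α → ¬ TerminatesWithOut (drop k S) (regs ι false α) (any ι R)))
        (sym split)
        (miscomputable-skipping Q g (subst Unique split u) ih
          (λ (w≡0 , f≡) → ¬acc (w≡0 , trans f≡ (sym (trans (cong length split) (length-++ Q))))))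
  where
  Q : List ℕ
  Q = reads (take k S)
  split : reads S ≡ Q ++ reads (drop k S)
  split = reads-take-drop k S

¬accepting⇒miscomputable : ∀ S → GoodSuffix S → Unique (reads S) → ¬ Accepting S → Miscomputable S
¬accepting⇒miscomputable = suffix-ind P (λ _ _ _ → ChoosableOn-intro λ _ _ → ¬TerminatesWithOut-[]) step
  where
  P : InstrSeq → Set
  P S = GoodSuffix S → Unique (reads S) → ¬ Accepting S → Miscomputable S
  step : ∀ u us → (∀ k → P (drop k us)) → P (u ∷ us)
  step _ _  ih halt _ ¬acc = contradiction (refl , refl) ¬acc
  step _ _  ih (good set1) _ _ =
    ChoosableOn-intro λ _ α out → contradiction (TerminatesWithOut-functional (2 , _ , refl , refl) out) λ ()
  step _ us ih (good (zjmp l ◂ g)) u ¬acc rewrite drop-summaries l us =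
    ChoosableOn-map (λ h α → h α ∘ to (TerminatesWithOut-jmp l us))
      (miscomputable-drop l us (GoodSuffix-drop l (good g)) u (ih l (GoodSuffix-drop l (good g))) ¬acc)
  step _ us ih (good (zpos i ◂ g)) u ¬acc rewrite drop-summaries 1 us with unsetPaths (summary us) ≟ 0
  ... | no  n≢0 =
    ChoosableOn-map (λ (ιi , h) α → h α ∘ TerminatesWithOut-reply {R = reads us} ιi
                                        ∘ to (TerminatesWithOut-pos i us ιi))
      (ChoosableOn-∷ true (Unique-head u) (unsetPaths≢0⇒avoids-set us (good g) (Unique-tail u) n≢0))
  ... | yes n≡0 =
    ChoosableOn-map (λ (ιi , h) α → h α ∘ TerminatesWithOut-reply {R = reads us} ιi
                                        ∘ to (TerminatesWithOut-pos i us ιi))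
      (ChoosableOn-∷ false (Unique-head u)
        (miscomputable-drop 1 us (GoodSuffix-drop 1 (good g)) (Unique-tail u) (ih 1 (GoodSuffix-drop 1 (good g)))
          (λ (w≡0 , f≡) → ¬acc (trans (cong (_+ wrongPaths (summary (drop 1 us))) n≡0) w≡0 , cong suc f≡))))
  step _ us ih (good (zneg i ◂ g)) u ¬acc rewrite drop-summaries 1 us with unsetPaths (summary (drop 1 us)) ≟ 0
  ... | no  s≢0 =
    ChoosableOn-map (λ (ιi , h) α → h α ∘ TerminatesWithOut-reply {R = reads us} ιi
                                        ∘ to (TerminatesWithOut-neg i us ιi))
      (ChoosableOn-∷ true (Unique-head u) (ChoosableOn-⊆ (∈-reads-drop 1 us)
        (unsetPaths≢0⇒avoids-set (drop 1 us) (GoodSuffix-drop 1 (good g)) (Unique-reads-drop 1 us (Unique-tail u)) s≢0)))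
  ... | yes s≡0 =
    ChoosableOn-map (λ (ιi , h) α → h α ∘ TerminatesWithOut-reply {R = reads us} ιi
                                        ∘ to (TerminatesWithOut-neg i us ιi))
      (ChoosableOn-∷ false (Unique-head u)
        (ih 0 (good g) (Unique-tail u)
          (λ (w≡0 , f≡) → ¬acc (trans (cong (_+ wrongPaths (summary us)) s≡0) w≡0 , cong suc f≡))))

-- Which very good sequences compute tstnz

tstnz≡true⇔ : ∀ n (bs : Vec Bool n) → tstnz n bs ≡ true ⇔ ∃ λ i → lookup bs i ≡ true
tstnz≡true⇔ n bs = mk⇔ (witness n bs) (λ (i , e) → holds n bs i e)
  where
  witness : ∀ n (bs : Vec Bool n) → tstnz n bs ≡ true → ∃ λ i → lookup bs i ≡ true
  witness (suc n) (true  ∷ᵥ bs) _ = fzero , refl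
  witness (suc n) (false ∷ᵥ bs) e with i , eᵢ ← witness n bs e = fsuc i , eᵢ
  holds : ∀ n (bs : Vec Bool n) i → lookup bs i ≡ true → tstnz n bs ≡ true
  holds (suc n) (b ∷ᵥ bs) fzero    refl = refl
  holds (suc n) (b ∷ᵥ bs) (fsuc i) e rewrite holds n bs i e with b
  ... | true  = refl
  ... | false = refl

any-reads≡tstnz : ∀ {n X} → IregsIs1toN X n → ∀ (bs : Vec Bool n) ι →
                  (∀ i → ι (suc (toℕ i)) ≡ lookup bs i) → any ι (reads X) ≡ tstnz n bs
any-reads≡tstnz {n} {X} iregs bs ι agree = ⇔→≡ (mk⇔ ⇒ ⇐)
  where
  ⇒ : any ι (reads X) ≡ true → tstnz n bs ≡ true
  ⇒ e with x , x∈ , eₓ ← to any≡true⇔ e | to (iregs x) x∈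
  ... | s≤s z≤n , x≤n = from (tstnz≡true⇔ n bs)
    (fromℕ< x≤n , trans (sym (agree (fromℕ< x≤n))) (trans (cong (ι ∘ suc) (toℕ-fromℕ< x≤n)) eₓ))
  ⇐ : tstnz n bs ≡ true → any ι (reads X) ≡ true
  ⇐ e with i , eᵢ ← to (tstnz≡true⇔ n bs) e =
    from any≡true⇔ (suc (toℕ i) , from (iregs (suc (toℕ i))) (s≤s z≤n , toℕ<n i) , trans (agree i) eᵢ)

accepting⇔computes-tstnz : ∀ {n X} → VeryGood X → IregsIs1toN X n → Accepting X ⇔ Computes n (tstnz n) X
accepting⇔computes-tstnz {n} {X} (good-X , unique) iregs = mk⇔ sufficient necessary
  where
  gX : GoodSuffix X
  gX = good (Good⇒GoodSeq good-X)
  sufficient : Accepting X → Computes n (tstnz n) X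
  sufficient acc = 0 , λ bs ι α agree _ →
    subst (TerminatesWithOut X (regs ι false α)) (any-reads≡tstnz {X = X} iregs bs ι agree)
          (accepting⇒outputs-any X gX acc ι α)
  necessary : Computes n (tstnz n) X → Accepting X
  necessary (_ , computes) with accepting? X
  ... | yes acc = acc
  ... | no ¬acc with ι , _ , wrong ← ¬accepting⇒miscomputable X gX unique ¬acc (const false) =
    contradiction (subst (TerminatesWithOut X (regs ι false (const false)))
                         (sym (any-reads≡tstnz {X = X} iregs bs ι agree))
                         (computes bs ι (const false) agree (λ _ _ _ → refl)))
                  (wrong (const false))
    where
    bs : Vec Bool n
    bs = tabulate (ι ∘ suc ∘ toℕ)
    agree : ∀ i → ι (suc (toℕ i)) ≡ lookup bs i
    agree i = sym (lookup∘tabulate (ι ∘ suc ∘ toℕ) i)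

infixr 5 _▸_

data _⊢_↝_ (P : RAMProg) (c c' : Config) : Set where
  step : stepRAM P c ≡ next c' → P ⊢ c ↝ c'

data _⊢_↝⟨_⟩_ (P : RAMProg) : Config → ℕ → Config → Set where
  done : ∀ {c} → P ⊢ c ↝⟨ 0 ⟩ c
  _▸_  : ∀ {c c₁ c₂ k} → P ⊢ c ↝ c₁ → P ⊢ c₁ ↝⟨ k ⟩ c₂ → P ⊢ c ↝⟨ suc k ⟩ c₂

_++↝_ : ∀ {P c₁ c₂ c₃ k l} →
        P ⊢ c₁ ↝⟨ k ⟩ c₂ → P ⊢ c₂ ↝⟨ l ⟩ c₃ → P ⊢ c₁ ↝⟨ k + l ⟩ c₃
done       ++↝ s₂ = s₂
(s ▸ s₁) ++↝ s₂ = s ▸ (s₁ ++↝ s₂)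

runRAM-↝ : ∀ {P c c' k t o} → P ⊢ c ↝⟨ k ⟩ c' → runRAM t P c' ≡ just o → runRAM (k + t) P c ≡ just o
runRAM-↝ done run = run
runRAM-↝ {P} {c} (step s ▸ ss) run with stepRAM P c | s
... | .(next _) | refl = runRAM-↝ ss run

runRAM-mono : ∀ {P c t t' o} → runRAM t P c ≡ just o → t ≤ t' → runRAM t' P c ≡ just o
runRAM-mono {P} {c} {suc t} {suc t'} run (s≤s t≤t') with stepRAM P c
... | halted _ = run
... | next _   = runRAM-mono run t≤t'

module _ {P : RAMProg} {pc : ℕ} {r : ℕ → ℤ} {inp out : List ℤ} where

  add-step : ∀ {k a b m n} → nthR P pc ≡ just (add k a b) → r a ≡ + m → r b ≡ + n →
             P ⊢ config pc r inp out ↝ config (suc pc) (updZ r k (+ (m + n))) inp out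
  add-step e ra rb = step (go e ra rb)
    where
    go : ∀ {k a b m n} → nthR P pc ≡ just (add k a b) → r a ≡ + m → r b ≡ + n →
         stepRAM P (config pc r inp out) ≡ next (config (suc pc) (updZ r k (+ (m + n))) inp out)
    go e ra rb with nthR P pc | e
    ... | _ | refl rewrite ra | rb = refl

  sub-step : ∀ {k a b m n} → nthR P pc ≡ just (sub k a b) → r a ≡ + m → r b ≡ + n →
             P ⊢ config pc r inp out ↝ config (suc pc) (updZ r k (+ m - + n)) inp out
  sub-step e ra rb = step (go e ra rb)
    where
    go : ∀ {k a b m n} → nthR P pc ≡ just (sub k a b) → r a ≡ + m → r b ≡ + n →
         stepRAM P (config pc r inp out) ≡ next (config (suc pc) (updZ r k (+ m - + n)) inp out)
    go e ra rb with nthR P pc | e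
    ... | _ | refl rewrite ra | rb = refl

  ldind-step : ∀ {k a addr v} → nthR P pc ≡ just (ldind k a) → r a ≡ + addr → r addr ≡ v →
               P ⊢ config pc r inp out ↝ config (suc pc) (updZ r k v) inp out
  ldind-step e ra rv = step (go e ra rv)
    where
    go : ∀ {k a addr v} → nthR P pc ≡ just (ldind k a) → r a ≡ + addr → r addr ≡ v →
         stepRAM P (config pc r inp out) ≡ next (config (suc pc) (updZ r k v) inp out)
    go {a = a} e ra refl with nthR P pc | e
    ... | _ | refl with r a | ra
    ...   | _ | refl = refl

  stind-step : ∀ {k a addr v} → nthR P pc ≡ just (stind k a) → r k ≡ + addr → r a ≡ v →
               P ⊢ config pc r inp out ↝ config (suc pc) (updZ r addr v) inp out
  stind-step e rk rv = step (go e rk rv)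
    where
    go : ∀ {k a addr v} → nthR P pc ≡ just (stind k a) → r k ≡ + addr → r a ≡ v →
         stepRAM P (config pc r inp out) ≡ next (config (suc pc) (updZ r addr v) inp out)
    go {k = k} e rk refl with nthR P pc | e
    ... | _ | refl with r k | rk
    ...   | _ | refl = refl

  tra-jump : ∀ {m j x} → nthR P pc ≡ just (tra m j) → r j ≡ + suc x →
             P ⊢ config pc r inp out ↝ config m r inp out
  tra-jump e rj = step (go e rj)
    where
    go : ∀ {m j x} → nthR P pc ≡ just (tra m j) → r j ≡ + suc x →
         stepRAM P (config pc r inp out) ≡ next (config m r inp out)
    go {j = j} e rj with nthR P pc | e
    ... | _ | refl with r j | rj
    ...   | _ | refl = refl

  tra-fall : ∀ {m j v} → nthR P pc ≡ just (tra m j) → r j ≡ v → {{NonPositive v}} →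
             P ⊢ config pc r inp out ↝ config (suc pc) r inp out
  tra-fall e rj = step (go e rj)
    where
    go : ∀ {m j v} → nthR P pc ≡ just (tra m j) → r j ≡ v → {{NonPositive v}} →
         stepRAM P (config pc r inp out) ≡ next (config (suc pc) r inp out)
    go {j = j} e rj with nthR P pc | e
    ... | _ | refl with r j | rj
    ...   | + zero   | refl = refl
    ...   | -[1+ _ ] | refl = refl

m≤n⇒nonPositive : ∀ {m n} → m ≤ n → NonPositive (+ m - + n)
m≤n⇒nonPositive {m} {n} m≤n =
  subst NonPositive (sym (trans (m-n≡m⊖n m n) (⊖-≤ m≤n))) (neg-nonPositive (n ∸ m))
  where
  neg-nonPositive : ∀ x → NonPositive (- + x)
  neg-nonPositive zero    = _
  neg-nonPositive (suc _) = _

n<m⇒m-n≡suc : ∀ {m n} → n < m → + m - + n ≡ + suc (m ∸ suc n)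
n<m⇒m-n≡suc {m} {n} n<m = trans (m-n≡m⊖n m n) (trans (⊖-≥ (<⇒≤ n<m)) (cong +_ (+-∸-assoc 1 n<m)))

-- The decision procedure

-- Row j of a table occupies X(16 + 5j) … X(20 + 5j): the code and the
-- parameter of instruction j, then the summary of the suffix from j on.
-- Besides, X1 = 1, X15 = 0, X2 counts rows, X3 points into the current
-- row, X6 counts the reads met and X7 = len X.
decider : RAMProg
decider =
  -- 0: skip n and m; X1 = 1 and X3 points at row 0
    read 0 ∷ read 0 ∷ load 1 (+ 1) ∷ load 3 (+ 16)
  -- 4: copy instruction X2 into row X2, until ! has been copied
  ∷ read 4 ∷ read 5 ∷ stind 3 4 ∷ add 8 1 3 ∷ stind 8 5 ∷ add 2 1 2
  ∷ load 8 (+ 18) ∷ sub 9 4 8 ∷ tra 16 9 ∷ load 8 (+ 5) ∷ add 3 8 3 ∷ tra 4 1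
  -- 16: summarise rows X2 - 1, …, 0, then go to 110
  ∷ add 7 15 2 ∷ tra 19 2 ∷ tra 110 1
  -- 19: dispatch on the code of the row; out.set:1 is handled at once
  ∷ ldind 4 3
  ∷ load 8 (+ 18) ∷ sub 9 4 8 ∷ tra 36 9
  ∷ load 8 (+ 12) ∷ sub 9 4 8 ∷ tra 74 9
  ∷ load 8 (+ 6) ∷ sub 9 4 8 ∷ tra 57 9
  ∷ load 8 (+ 2) ∷ sub 9 4 8 ∷ tra 40 9
  ∷ load 10 (+ 0) ∷ load 11 (+ 1) ∷ load 12 (+ 0) ∷ tra 97 1
  -- 36: !
  ∷ load 10 (+ 1) ∷ load 11 (+ 0) ∷ load 12 (+ 0) ∷ tra 97 1
  -- 40: +in:i.get, from the rows of the next two instructions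
  ∷ add 6 1 6
  ∷ load 8 (+ 7) ∷ add 8 8 3 ∷ ldind 13 8
  ∷ load 8 (+ 12) ∷ add 8 8 3 ∷ ldind 14 8 ∷ add 10 13 14
  ∷ load 8 (+ 13) ∷ add 8 8 3 ∷ ldind 14 8 ∷ add 11 13 14
  ∷ load 8 (+ 14) ∷ add 8 8 3 ∷ ldind 12 8 ∷ add 12 1 12 ∷ tra 97 1
  -- 57: -in:i.get
  ∷ add 6 1 6
  ∷ load 8 (+ 12) ∷ add 8 8 3 ∷ ldind 13 8
  ∷ load 8 (+ 7) ∷ add 8 8 3 ∷ ldind 14 8 ∷ add 10 13 14
  ∷ load 8 (+ 8) ∷ add 8 8 3 ∷ ldind 14 8 ∷ add 11 13 14
  ∷ load 8 (+ 9) ∷ add 8 8 3 ∷ ldind 12 8 ∷ add 12 1 12 ∷ tra 97 1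
  -- 74: #l, from the row of its target unless that lies beyond the end
  ∷ add 8 1 3 ∷ ldind 5 8 ∷ add 9 2 5 ∷ sub 9 9 7 ∷ tra 93 9
  ∷ add 8 5 5 ∷ add 8 8 8 ∷ add 8 8 5 ∷ add 8 8 3
  ∷ load 9 (+ 2) ∷ add 9 9 8 ∷ ldind 10 9
  ∷ load 9 (+ 3) ∷ add 9 9 8 ∷ ldind 11 9
  ∷ load 9 (+ 4) ∷ add 9 9 8 ∷ ldind 12 9 ∷ tra 97 1
  -- 93: the target lies beyond the end
  ∷ load 10 (+ 1) ∷ load 11 (+ 1) ∷ load 12 (+ 0) ∷ tra 97 1
  -- 97: store X10, X11, X12 into the row and move to the previous row
  ∷ load 8 (+ 2) ∷ add 8 8 3 ∷ stind 8 10
  ∷ load 8 (+ 3) ∷ add 8 8 3 ∷ stind 8 11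
  ∷ load 8 (+ 4) ∷ add 8 8 3 ∷ stind 8 12
  ∷ load 8 (+ 5) ∷ sub 3 3 8 ∷ sub 2 2 1 ∷ tra 17 1
  -- 110: print 1 iff row 0 has wrongPaths = 0 and allFalseReads = X6
  ∷ load 8 (+ 19) ∷ ldind 11 8 ∷ load 8 (+ 20) ∷ ldind 12 8 ∷ tra 121 11
  ∷ sub 9 12 6 ∷ tra 121 9 ∷ sub 9 6 12 ∷ tra 121 9 ∷ print 1 ∷ tra 500 1
  -- 121: reject
  ∷ print 15 ∷ []

code : PrimInstr → ℕ
code (plain a) = basicCode a
code (pos a)   = 6 + basicCode a
code (neg a)   = 12 + basicCode a
code (jmp _)   = 18
code term      = 19

param : PrimInstr → ℤ
param (plain a) = basicParam a
param (pos a)   = basicParam a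
param (neg a)   = basicParam a
param (jmp l)   = + l
param term      = -[1+ 0 ]

encodeInstr≡ : ∀ u → encodeInstr u ≡ + code u ∷ param u ∷ []
encodeInstr≡ (plain a) = refl
encodeInstr≡ (pos a)   = refl
encodeInstr≡ (neg a)   = refl
encodeInstr≡ (jmp l)   = refl
encodeInstr≡ term      = refl

cell : ℕ → ℕ → ℕ
cell j k = 16 + (k + j * 5)

column : ∀ k → {T (k <ᵇ 5)} → k < 5
column k {k<5} = <ᵇ⇒< k 5 k<5

cell-injective : ∀ {j j' k k'} → k < 5 → k' < 5 → cell j k ≡ cell j' k' → j ≡ j' × k ≡ k'
cell-injective {j} {j'} {k} {k'} k<5 k'<5 e = *-cancelʳ-≡ j j' 5 (+-cancelˡ-≡ k _ _ e') , k≡k'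
  where
  open ≡-Reasoning
  e₀ : k + j * 5 ≡ k' + j' * 5
  e₀ = +-cancelˡ-≡ 16 _ _ e
  k≡k' : k ≡ k'
  k≡k' = begin
    k                  ≡⟨ sym (m<n⇒m%n≡m k<5) ⟩
    k % 5              ≡⟨ sym ([m+kn]%n≡m%n k j 5) ⟩
    (k + j * 5) % 5    ≡⟨ cong (_% 5) e₀ ⟩
    (k' + j' * 5) % 5  ≡⟨ [m+kn]%n≡m%n k' j' 5 ⟩
    k' % 5             ≡⟨ m<n⇒m%n≡m k'<5 ⟩
    k'                 ∎
  e' : k + j * 5 ≡ k + j' * 5
  e' = trans e₀ (cong (_+ j' * 5) (sym k≡k'))

updZ-same : ∀ f i v → updZ f i v i ≡ v
updZ-same f i v with i ≡ᵇ i | ≡⇒≡ᵇ i i refl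
... | true | _ = refl

updZ-other : ∀ f {i} v {j} → j ≢ i → updZ f i v j ≡ f j
updZ-other f {i} v {j} j≢i with j ≡ᵇ i in eq
... | false = refl
... | true  = contradiction (≡ᵇ⇒≡ j i (subst T (sym eq) _)) j≢i

StoresInstr : (ℕ → ℤ) → ℕ → PrimInstr → Set
StoresInstr r j u = r (cell j 0) ≡ + code u × r (cell j 1) ≡ param u

StoresSummary : (ℕ → ℤ) → (a b c : ℕ) → Summary → Set
StoresSummary r a b c s = r a ≡ + unsetPaths s × r b ≡ + wrongPaths s × r c ≡ + allFalseReads s

-- Turns a summary equation into StoresSummary where evaluation fills the registers.
components-cong : ∀ {s s'} → s ≡ s' →
  + unsetPaths s ≡ + unsetPaths s' × + wrongPaths s ≡ + wrongPaths s' × + allFalseReads s ≡ + allFalseReads s'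
components-cong refl = refl , refl , refl

RowSummary : (ℕ → ℤ) → ℕ → Summary → Set
RowSummary r j = StoresSummary r (cell j 2) (cell j 3) (cell j 4)

updZ-cell : ∀ f v j k j' k' → k < 5 → k' < 5 → ¬ (j ≡ j' × k ≡ k') →
            updZ f (cell j' k') v (cell j k) ≡ f (cell j k)
updZ-cell f v j k j' k' k<5 k'<5 ne = updZ-other f v (ne ∘ cell-injective k<5 k'<5)

storeInstr : (ℕ → ℤ) → ℕ → PrimInstr → ℕ → ℤ
storeInstr r j u = updZ (updZ r (cell j 0) (+ code u)) (cell j 1) (param u)

storeInstr-here : ∀ r j u → StoresInstr (storeInstr r j u) j u
storeInstr-here r j u =
  trans (updZ-cell (updZ r (cell j 0) (+ code u)) (param u) j 0 j 1 (column 0) (column 1) (λ ()))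
        (updZ-same r (cell j 0) _) ,
  updZ-same (updZ r (cell j 0) (+ code u)) (cell j 1) _

storeInstr-elsewhere : ∀ r j u j' {w} → j' ≢ j → StoresInstr r j' w → StoresInstr (storeInstr r j u) j' w
storeInstr-elsewhere r j u j' j'≢j (c , p) = trans (unchanged (column 0)) c , trans (unchanged (column 1)) p
  where
  unchanged : ∀ {k} → k < 5 → storeInstr r j u (cell j' k) ≡ r (cell j' k)
  unchanged {k} k<5 = trans (updZ-cell (updZ r (cell j 0) (+ code u)) (param u) j' k j 1 k<5 (column 1) (j'≢j ∘ proj₁))
                            (updZ-cell r (+ code u) j' k j 0 k<5 (column 0) (j'≢j ∘ proj₁))

storeRow : (ℕ → ℤ) → ℕ → (a b c : ℤ) → ℕ → ℤ
storeRow r j a b c = updZ (updZ (updZ r (cell j 2) a) (cell j 3) b) (cell j 4) c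

storeRow-here : ∀ r j a b c →
  storeRow r j a b c (cell j 2) ≡ a × storeRow r j a b c (cell j 3) ≡ b × storeRow r j a b c (cell j 4) ≡ c
storeRow-here r j a b c =
  trans (updZ-cell r₂ c j 2 j 4 (column 2) (column 4) (λ ()))
        (trans (updZ-cell r₁ b j 2 j 3 (column 2) (column 3) (λ ())) (updZ-same r (cell j 2) a)) ,
  trans (updZ-cell r₂ c j 3 j 4 (column 3) (column 4) (λ ())) (updZ-same r₁ (cell j 3) b) ,
  updZ-same r₂ (cell j 4) c
  where
  r₁ r₂ : ℕ → ℤ
  r₁ = updZ r (cell j 2) a
  r₂ = updZ r₁ (cell j 3) b

storeRow-unchanged : ∀ r j a b c {j' k} → k < 5 → ¬ (j' ≡ j × 2 ≤ k) →
                     storeRow r j a b c (cell j' k) ≡ r (cell j' k)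
storeRow-unchanged r j a b c {j'} {k} k<5 ne =
  trans (updZ-cell (updZ r₁ (cell j 3) b) c j' k j 4 k<5 (column 4) (not 4))
        (trans (updZ-cell r₁ b j' k j 3 k<5 (column 3) (not 3)) (updZ-cell r a j' k j 2 k<5 (column 2) (not 2)))
  where
  r₁ : ℕ → ℤ
  r₁ = updZ r (cell j 2) a
  not : ∀ k' → {T (2 ≤ᵇ k')} → ¬ (j' ≡ j × k ≡ k')
  not k' {2≤k'} (e , refl) = ne (e , ≤ᵇ⇒≤ 2 k' 2≤k')

drop-suc : ∀ {A : Set} p (xs : List A) {y ys} → drop p xs ≡ y ∷ ys → drop (suc p) xs ≡ ys
drop-suc zero    (x ∷ xs) refl = refl
drop-suc (suc p) (x ∷ xs) e    = drop-suc p xs e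

drop-past : ∀ {A : Set} p l (xs : List A) {y ys} → drop p xs ≡ y ∷ ys → drop l ys ≡ drop (p + suc l) xs
drop-past p l xs {y} {ys} e = begin
  drop l ys                ≡⟨ cong (drop l) (sym (drop-suc p xs e)) ⟩
  drop l (drop (suc p) xs) ≡⟨ drop-drop (suc p) l xs ⟩
  drop (suc p + l) xs      ≡⟨ cong (λ k → drop k xs) (sym (+-suc p l)) ⟩
  drop (p + suc l) xs      ∎
  where open ≡-Reasoning

drop≡∷⇒< : ∀ {A : Set} p (xs : List A) {y ys} → drop p xs ≡ y ∷ ys → p < length xs
drop≡∷⇒< zero    (x ∷ xs) _ = s≤s z≤n
drop≡∷⇒< (suc p) (x ∷ xs) e = s≤s (drop≡∷⇒< p xs e)

drop≡[_]⇒length : ∀ {A : Set} p (xs : List A) {y} → drop p xs ≡ y ∷ [] → length xs ≡ suc p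
drop≡[_]⇒length zero    (x ∷ []) refl = refl
drop≡[_]⇒length (suc p) (x ∷ xs) e    = cong suc (drop≡[_]⇒length p xs e)

drop≡[]⇒length≤ : ∀ {A : Set} p (xs : List A) → drop p xs ≡ [] → length xs ≤ p
drop≡[]⇒length≤ zero    []       _ = z≤n
drop≡[]⇒length≤ (suc p) []       _ = z≤n
drop≡[]⇒length≤ (suc p) (x ∷ xs) e = s≤s (drop≡[]⇒length≤ p xs e)

GoodSeq-∷∷ : ∀ {S} → GoodSeq S → ∃ λ y → ∃ λ y' → ∃ λ ys → S ≡ y ∷ y' ∷ ys
GoodSeq-∷∷ set1    = _ , _ , _ , refl
GoodSeq-∷∷ (z ◂ g) with _ , _ , _ , refl ← GoodSeq-∷∷ g = _ , _ , _ , refl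

jump-address : ∀ p l k → k + ((((l + l) + (l + l)) + l) + (11 + suc p * 5)) ≡ 16 + (k + (p + l) * 5)
jump-address = solve-∀

ZInstr-code≤18 : ∀ {u} → ZInstr u → code u ≤ 18
ZInstr-code≤18 (zpos i) = ≤ᵇ⇒≤ 6 18 _
ZInstr-code≤18 (zneg i) = ≤ᵇ⇒≤ 12 18 _
ZInstr-code≤18 (zjmp l) = ≤-refl

module Decider (X : InstrSeq) (gX : GoodSeq X) where

  N : ℕ
  N = length X

  instrAt : ℕ → PrimInstr
  instrAt j = headOr term (drop j X)

  0<N : 0 < N
  0<N with _ , _ , _ , e ← GoodSeq-∷∷ gX = drop≡∷⇒< 0 X e

  record Loaded (q : ℕ) (r : ℕ → ℤ) : Set where
    field
      one     : r 1 ≡ + 1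
      count   : r 2 ≡ + q
      pointer : r 3 ≡ + cell q 0
      noReads : r 6 ≡ + 0
      zero15  : r 15 ≡ + 0
      instrs  : ∀ j → j < q → StoresInstr r j (instrAt j)

  -- X3 points at row q - 1, the next one to be summarised.
  record Frame (q : ℕ) (r : ℕ → ℤ) : Set where
    field
      q≤N     : q ≤ N
      one     : r 1 ≡ + 1
      count   : r 2 ≡ + q
      pointer : r 3 ≡ + (11 + q * 5)
      size    : r 7 ≡ + N
      zero15  : r 15 ≡ + 0
      instrs  : ∀ j → j < N → StoresInstr r j (instrAt j)
      rows    : ∀ j → q ≤ j → j < N → RowSummary r j (summary (drop j X))

  record Summarised (q : ℕ) (r : ℕ → ℤ) : Set where
    field
      frame : Frame q r
      seen  : r 6 ≡ + readCount (drop q X)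

  instrs-extend : ∀ {q} r {u R} → (∀ j → j < q → StoresInstr r j (instrAt j)) → drop q X ≡ u ∷ R →
                  ∀ j → j < suc q → StoresInstr (storeInstr r q u) j (instrAt j)
  instrs-extend {q} r {u} old e j j<1+q with m≤n⇒m<n∨m≡n (s≤s⁻¹ j<1+q)
  ... | inj₁ j<q  = storeInstr-elsewhere r q u j {instrAt j} (<⇒≢ j<q) (old j j<q)
  ... | inj₂ refl = subst (StoresInstr (storeInstr r q u) q) (sym (cong (headOr term) e)) (storeInstr-here r q u)

  load-step : ∀ {q r R inp} u → code u ≤ 18 → Loaded q r → drop q X ≡ u ∷ R →
    ∃ λ r' → decider ⊢ config 4 r (+ code u ∷ param u ∷ inp) [] ↝⟨ 12 ⟩ config 4 r' inp [] × Loaded (suc q) r'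
  load-step {r = r} u code≤18 L e = _ ,
    (step refl ▸ step refl ▸ stind-step {v = + code u} refl pointer refl ▸ add-step refl one pointer ▸
     stind-step {v = param u} refl refl refl ▸ add-step refl one count ▸ step refl ▸ sub-step refl refl refl ▸
     tra-fall refl refl {{m≤n⇒nonPositive code≤18}} ▸ step refl ▸ add-step refl refl pointer ▸ tra-jump refl one ▸
     done) ,
    record { one = one ; count = refl ; pointer = refl ; noReads = noReads ; zero15 = zero15
           ; instrs = instrs-extend r instrs e }
    where open Loaded L

  load-last : ∀ {q r} → Loaded q r → drop q X ≡ term ∷ [] →
    ∃ λ r' → decider ⊢ config 4 r (+ 19 ∷ -[1+ 0 ] ∷ []) [] ↝⟨ 10 ⟩ config 17 r' [] [] × Summarised N r'
  load-last {q} {r} L e = _ ,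
    (step refl ▸ step refl ▸ stind-step {v = + 19} refl pointer refl ▸ add-step refl one pointer ▸
     stind-step {v = -[1+ 0 ]} refl refl refl ▸ add-step refl one count ▸ step refl ▸ sub-step refl refl refl ▸
     step refl ▸ add-step refl zero15 refl ▸ done) ,
    record
      { frame = record
        { q≤N     = ≤-refl
        ; one     = one
        ; count   = cong +_ (sym N≡)
        ; pointer = trans pointer (cong (λ n → + (11 + n * 5)) (sym N≡))
        ; size    = cong +_ (sym N≡)
        ; zero15  = zero15
        ; instrs  = λ j j<N → instrs-extend r instrs e j (subst (j <_) N≡ j<N)
        ; rows    = λ j N≤j j<N → contradiction N≤j (<⇒≱ j<N)
        }
      ; seen = trans noReads (cong (+_ ∘ readCount) (sym (drop-all N X ≤-refl)))
      }
    where
    open Loaded L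
    N≡ : N ≡ suc q
    N≡ = drop≡[_]⇒length q X e

  load-all : ∀ {q r R} → GoodSeq R → Loaded q r → drop q X ≡ R →
    ∃₂ λ k r' → k ≤ length R * 12 ×
      decider ⊢ config 4 r (concatMap encodeInstr R) [] ↝⟨ k ⟩ config 17 r' [] [] × Summarised N r'
  load-all {q} set1 L e
    with r₁ , s₁ , L₁ ← load-step (plain (outSet true)) (≤ᵇ⇒≤ 2 18 _) L e
    with r₂ , s₂ , S  ← load-last L₁ (drop-suc q X e) =
    _ , r₂ , ≤ᵇ⇒≤ 22 24 _ , s₁ ++↝ s₂ , S
  load-all {q} {r} {u ∷ us} (z ◂ g) L e
    with r₁ , s₁ , L₁ ← load-step u (ZInstr-code≤18 z) L e
    with k , r₂ , k≤ , s₂ , S ← load-all g L₁ (drop-suc q X e) =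
    12 + k , r₂ , +-monoʳ-≤ 12 k≤ ,
    subst (λ inp → decider ⊢ config 4 r inp [] ↝⟨ 12 + k ⟩ config 17 r₂ [] [])
          (sym (cong (_++ concatMap encodeInstr us) (encodeInstr≡ u))) (s₁ ++↝ s₂) ,
    S

  record Computed (p : ℕ) (r : ℕ → ℤ) : Set where
    field
      frame   : Frame (suc p) r
      seen    : r 6 ≡ + readCount (drop p X)
      current : StoresSummary r 10 11 12 (summary (drop p X))

  Branch : ℕ → (ℕ → ℤ) → Set
  Branch p r = ∃₂ λ k r' → k ≤ 47 × decider ⊢ config 17 r [] [] ↝⟨ k ⟩ config 97 r' [] [] × Computed p r'

  -- A branch writes only registers 4–6 and 8–14, so these hypotheses hold by evaluation.
  reframe : ∀ {q r r'} → r' 1 ≡ r 1 → r' 2 ≡ r 2 → r' 3 ≡ r 3 → r' 7 ≡ r 7 → r' 15 ≡ r 15 →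
            (∀ x → r' (16 + x) ≡ r (16 + x)) → Frame q r → Frame q r'
  reframe e₁ e₂ e₃ e₇ e₁₅ table F = record
    { q≤N     = q≤N
    ; one     = trans e₁ one
    ; count   = trans e₂ count
    ; pointer = trans e₃ pointer
    ; size    = trans e₇ size
    ; zero15  = trans e₁₅ zero15
    ; instrs  = λ j j<N → let c , a = instrs j j<N in trans (table _) c , trans (table _) a
    ; rows    = λ j q≤j j<N → let u , w , f = rows j q≤j j<N in
                  trans (table _) u , trans (table _) w , trans (table _) f
    }
    where open Frame F

  code-at : ∀ {q r p u rest} → Frame q r → p < N → drop p X ≡ u ∷ rest → r (cell p 0) ≡ + code u
  code-at F p<N e = trans (proj₁ (Frame.instrs F _ p<N)) (cong (+_ ∘ code ∘ headOr term) e)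

  param-at : ∀ {q r p u rest} → Frame q r → p < N → drop p X ≡ u ∷ rest → r (cell p 1) ≡ param u
  param-at F p<N e = trans (proj₂ (Frame.instrs F _ p<N)) (cong (param ∘ headOr term) e)

  readCount-at : ∀ {p u rest} → drop p X ≡ u ∷ rest → readCount (drop (suc p) X) ≡ readCount rest
  readCount-at {p} e = cong readCount (drop-suc p X e)

  seen-past : ∀ {p r u rest} → Summarised (suc p) r → drop p X ≡ u ∷ rest →
              readCount (u ∷ rest) ≡ readCount rest → r 6 ≡ + readCount (drop p X)
  seen-past S e nonRead =
    trans (Summarised.seen S) (cong +_ (trans (readCount-at e) (trans (sym nonRead) (sym (cong readCount e)))))

  term-branch : ∀ {p r} → Summarised (suc p) r → drop p X ≡ term ∷ [] → Branch p r
  term-branch S e = _ , _ , ≤ᵇ⇒≤ 9 47 _ ,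
    (tra-jump refl count ▸ ldind-step refl pointer (code-at F q≤N e) ▸
     step refl ▸ sub-step refl refl refl ▸ step refl ▸
     step refl ▸ step refl ▸ step refl ▸ tra-jump refl one ▸ done) ,
    record
      { frame   = reframe refl refl refl refl refl (λ _ → refl) F
      ; seen    = seen-past S e refl
      ; current = components-cong (cong summary (sym e))
      }
    where
    open Summarised S renaming (frame to F)
    open Frame F

  set-branch : ∀ {p r} → Summarised (suc p) r → drop p X ≡ plain (outSet true) ∷ term ∷ [] → Branch p r
  set-branch S e = _ , _ , ≤ᵇ⇒≤ 18 47 _ ,
    (tra-jump refl count ▸ ldind-step refl pointer (code-at F q≤N e) ▸
     step refl ▸ sub-step refl refl refl ▸ step refl ▸ step refl ▸ sub-step refl refl refl ▸ step refl ▸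
     step refl ▸ sub-step refl refl refl ▸ step refl ▸ step refl ▸ sub-step refl refl refl ▸ step refl ▸
     step refl ▸ step refl ▸ step refl ▸ tra-jump refl one ▸ done) ,
    record
      { frame   = reframe refl refl refl refl refl (λ _ → refl) F
      ; seen    = seen-past S e refl
      ; current = components-cong (cong summary (sym e))
      }
    where
    open Summarised S renaming (frame to F)
    open Frame F

  jmp-branch : ∀ {p r l rest} → Summarised (suc p) r → drop p X ≡ jmp (suc l) ∷ rest → Branch p r
  jmp-branch {p} {r} {l} {rest} S e with drop (p + suc l) X in d
  ... | [] = _ , _ , ≤ᵇ⇒≤ 17 47 _ ,
    (tra-jump refl count ▸ ldind-step refl pointer (code-at F q≤N e) ▸
     step refl ▸ sub-step refl refl refl ▸ step refl ▸ step refl ▸ sub-step refl refl refl ▸ step refl ▸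
     add-step refl one pointer ▸ ldind-step refl refl (param-at F q≤N e) ▸ add-step refl count refl ▸
     sub-step refl refl size ▸
     tra-jump refl (n<m⇒m-n≡suc (s≤s (drop≡[]⇒length≤ (p + suc l) X d))) ▸
     step refl ▸ step refl ▸ step refl ▸ tra-jump refl one ▸ done) ,
    record
      { frame   = reframe refl refl refl refl refl (λ _ → refl) F
      ; seen    = seen-past S e refl
      ; current = components-cong (sym (trans (cong summary e)
                    (trans (summary-jmp l rest) (cong summary (trans (drop-past p l X e) d)))))
      }
    where
    F : Frame (suc p) r
    F = Summarised.frame S
    open Frame F using (one; count; pointer; size; q≤N)
  ... | _ ∷ _ = _ , _ , ≤ᵇ⇒≤ 27 47 _ ,
    (tra-jump refl count ▸ ldind-step refl pointer (code-at F q≤N e) ▸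
     step refl ▸ sub-step refl refl refl ▸ step refl ▸ step refl ▸ sub-step refl refl refl ▸ step refl ▸
     add-step refl one pointer ▸ ldind-step refl refl (param-at F q≤N e) ▸ add-step refl count refl ▸
     sub-step refl refl size ▸
     tra-fall refl refl {{m≤n⇒nonPositive within}} ▸
     add-step refl refl refl ▸ add-step refl refl refl ▸ add-step refl refl refl ▸ add-step refl refl pointer ▸
     step refl ▸ add-step refl refl refl ▸ ldind-step refl (address 2) (proj₁ target) ▸
     step refl ▸ add-step refl refl refl ▸ ldind-step refl (address 3) (proj₁ (proj₂ target)) ▸
     step refl ▸ add-step refl refl refl ▸ ldind-step refl (address 4) (proj₂ (proj₂ target)) ▸
     tra-jump refl one ▸ done) ,
    record
      { frame   = reframe refl refl refl refl refl (λ _ → refl) F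
      ; seen    = seen-past S e refl
      ; current = components-cong (sym (trans (cong summary e)
                    (trans (summary-jmp l rest) (cong summary (drop-past p l X e)))))
      }
    where
    F : Frame (suc p) r
    F = Summarised.frame S
    open Frame F using (one; count; pointer; size; q≤N; rows)
    within : suc p + suc l ≤ N
    within = drop≡∷⇒< (p + suc l) X d
    address : ∀ k → + (k + ((((suc l + suc l) + (suc l + suc l)) + suc l) + (11 + suc p * 5)))
                    ≡ + cell (p + suc l) k
    address = cong +_ ∘ jump-address p (suc l)
    target : RowSummary r (p + suc l) (summary (drop (p + suc l) X))
    target = rows (p + suc l) (subst (suc p ≤_) (sym (+-suc p l)) (s≤s (m≤m+n p l))) within

  -- a test is followed by at least two instructions, whose rows are already summarised
  next-two : ∀ {p r u rest} → Frame (suc p) r → drop p X ≡ u ∷ rest → GoodSeq rest →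
    RowSummary r (suc p) (summary rest) × RowSummary r (suc (suc p)) (summary (drop 1 rest))
  next-two {p} {r} F e g with y , y' , ys , refl ← GoodSeq-∷∷ g =
    subst (RowSummary r (suc p) ∘ summary) d₁ (rows (suc p) ≤-refl (drop≡∷⇒< (suc p) X d₁)) ,
    subst (RowSummary r (suc (suc p)) ∘ summary) d₂
          (rows (suc (suc p)) (n≤1+n _) (drop≡∷⇒< (suc (suc p)) X d₂))
    where
    open Frame F
    d₁ : drop (suc p) X ≡ y ∷ y' ∷ ys
    d₁ = drop-suc p X e
    d₂ : drop (suc (suc p)) X ≡ y' ∷ ys
    d₂ = drop-suc (suc p) X d₁

  pos-branch : ∀ {p r i rest} → Summarised (suc p) r → drop p X ≡ pos (inGet i) ∷ rest → GoodSeq rest → Branch p r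
  pos-branch {p} {r} {i} {rest} S e g = _ , _ , ≤ᵇ⇒≤ 31 47 _ ,
    (tra-jump refl count ▸ ldind-step refl pointer (code-at F q≤N e) ▸
     step refl ▸ sub-step refl refl refl ▸ step refl ▸ step refl ▸ sub-step refl refl refl ▸ step refl ▸
     step refl ▸ sub-step refl refl refl ▸ step refl ▸ step refl ▸ sub-step refl refl refl ▸ step refl ▸
     add-step refl one (Summarised.seen S) ▸
     step refl ▸ add-step refl refl pointer ▸ ldind-step refl refl (proj₁ nextRow) ▸
     step refl ▸ add-step refl refl pointer ▸ ldind-step refl refl (proj₁ skipRow) ▸ add-step refl refl refl ▸
     step refl ▸ add-step refl refl pointer ▸ ldind-step refl refl (proj₁ (proj₂ skipRow)) ▸ add-step refl refl refl ▸
     step refl ▸ add-step refl refl pointer ▸ ldind-step refl refl (proj₂ (proj₂ skipRow)) ▸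
     add-step refl one refl ▸ tra-jump refl one ▸ done) ,
    record
      { frame   = reframe refl refl refl refl refl (λ _ → refl) F
      ; seen    = trans (cong (+_ ∘ suc) (readCount-at e)) (sym (cong (+_ ∘ readCount) e))
      ; current = components-cong (sym (trans (cong summary e) (summary-pos i rest)))
      }
    where
    F : Frame (suc p) r
    F = Summarised.frame S
    open Frame F using (one; count; pointer; q≤N)
    nextRow : RowSummary r (suc p) (summary rest)
    nextRow = proj₁ (next-two F e g)
    skipRow : RowSummary r (suc (suc p)) (summary (drop 1 rest))
    skipRow = proj₂ (next-two F e g)

  neg-branch : ∀ {p r i rest} → Summarised (suc p) r → drop p X ≡ neg (inGet i) ∷ rest → GoodSeq rest → Branch p r
  neg-branch {p} {r} {i} {rest} S e g = _ , _ , ≤ᵇ⇒≤ 28 47 _ ,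
    (tra-jump refl count ▸ ldind-step refl pointer (code-at F q≤N e) ▸
     step refl ▸ sub-step refl refl refl ▸ step refl ▸ step refl ▸ sub-step refl refl refl ▸ step refl ▸
     step refl ▸ sub-step refl refl refl ▸ step refl ▸
     add-step refl one (Summarised.seen S) ▸
     step refl ▸ add-step refl refl pointer ▸ ldind-step refl refl (proj₁ skipRow) ▸
     step refl ▸ add-step refl refl pointer ▸ ldind-step refl refl (proj₁ nextRow) ▸ add-step refl refl refl ▸
     step refl ▸ add-step refl refl pointer ▸ ldind-step refl refl (proj₁ (proj₂ nextRow)) ▸ add-step refl refl refl ▸
     step refl ▸ add-step refl refl pointer ▸ ldind-step refl refl (proj₂ (proj₂ nextRow)) ▸
     add-step refl one refl ▸ tra-jump refl one ▸ done) ,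
    record
      { frame   = reframe refl refl refl refl refl (λ _ → refl) F
      ; seen    = trans (cong (+_ ∘ suc) (readCount-at e)) (sym (cong (+_ ∘ readCount) e))
      ; current = components-cong (sym (trans (cong summary e) (summary-neg i rest)))
      }
    where
    F : Frame (suc p) r
    F = Summarised.frame S
    open Frame F using (one; count; pointer; q≤N)
    nextRow : RowSummary r (suc p) (summary rest)
    nextRow = proj₁ (next-two F e g)
    skipRow : RowSummary r (suc (suc p)) (summary (drop 1 rest))
    skipRow = proj₂ (next-two F e g)

  branch : ∀ {p r} → Summarised (suc p) r → Branch p r
  branch {p} S with drop p X in e | GoodSuffix-drop p (good gX)
  ... | _ | empty              = ⊥-elim (<⇒≱ (Frame.q≤N (Summarised.frame S)) (drop≡[]⇒length≤ p X e))
  ... | _ | halt               = term-branch S e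
  ... | _ | good set1          = set-branch S e
  ... | _ | good (zjmp l ◂ _)  = jmp-branch S e
  ... | _ | good (zpos i ◂ g)  = pos-branch S e g
  ... | _ | good (zneg i ◂ g)  = neg-branch S e g

  store : ∀ {p r} → Computed p r →
    ∃ λ r' → decider ⊢ config 97 r [] [] ↝⟨ 13 ⟩ config 17 r' [] [] × Summarised p r'
  store {p} {r} C = _ ,
    (step refl ▸ add-step refl refl pointer ▸ stind-step refl refl (proj₁ current) ▸
     step refl ▸ add-step refl refl pointer ▸ stind-step refl refl (proj₁ (proj₂ current)) ▸
     step refl ▸ add-step refl refl pointer ▸ stind-step refl refl (proj₂ (proj₂ current)) ▸
     step refl ▸ sub-step refl pointer refl ▸ sub-step refl count one ▸ tra-jump refl one ▸ done) ,
    record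
      { frame = record
        { q≤N     = <⇒≤ q≤N
        ; one     = one
        ; count   = refl
        ; pointer = refl
        ; size    = size
        ; zero15  = zero15
        ; instrs  = λ j j<N → let c , a = instrs j j<N in
                      trans (kept j (column 0) λ { (_ , ()) }) c , trans (kept j (column 1) λ { (_ , s≤s ()) }) a
        ; rows    = rows′
        }
      ; seen = seen
      }
    where
    open Computed C
    open Frame frame
    s : Summary
    s = summary (drop p X)
    new : ℕ → ℤ
    new = storeRow r p (+ unsetPaths s) (+ wrongPaths s) (+ allFalseReads s)
    kept : ∀ j {k} → k < 5 → ¬ (j ≡ p × 2 ≤ k) → new (cell j k) ≡ r (cell j k)
    kept j = storeRow-unchanged r p _ _ _ {j}
    rows′ : ∀ j → p ≤ j → j < N → RowSummary new j (summary (drop j X))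
    rows′ j p≤j j<N with m≤n⇒m<n∨m≡n p≤j
    ... | inj₁ p<j = let u , w , f = rows j p<j j<N in
                     trans (kept j (column 2) other) u , trans (kept j (column 3) other) w , trans (kept j (column 4) other) f
      where
      other : ∀ {k} → ¬ (j ≡ p × 2 ≤ k)
      other (j≡p , _) = <⇒≢ p<j (sym j≡p)
    ... | inj₂ refl = storeRow-here r p _ _ _

  iteration : ∀ {p r} → Summarised (suc p) r →
    ∃₂ λ k r' → k ≤ 60 × decider ⊢ config 17 r [] [] ↝⟨ k ⟩ config 17 r' [] [] × Summarised p r'
  iteration S with k , _ , k≤47 , s₁ , C ← branch S with r' , s₂ , S' ← store C =
    k + 13 , r' , +-monoˡ-≤ 13 k≤47 , s₁ ++↝ s₂ , S'

  finish : ∀ {r} → Summarised 0 r →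
    runRAM 20 decider (config 17 r [] []) ≡ just (boolToℤ (does (accepting? X)) ∷ [])
  finish {r} S = verdict _ _ _ (proj₁ (proj₂ row₀)) (proj₂ (proj₂ row₀)) seen
    where
    open Summarised S
    open Frame frame
    row₀ : RowSummary r 0 (summary X)
    row₀ = rows 0 z≤n 0<N
    halts : ∀ {k c v o} → decider ⊢ config 17 r [] [] ↝⟨ k ⟩ c → runRAM 1 decider c ≡ just (v ∷ []) →
            v ≡ o → k ≤ 19 → runRAM 20 decider (config 17 r [] []) ≡ just (o ∷ [])
    halts steps stop v≡o k≤19 =
      runRAM-mono (trans (runRAM-↝ steps stop) (cong (λ v → just (v ∷ [])) v≡o)) (+-monoˡ-≤ 1 k≤19)
    -- 17 … 113: X11 and X12 get wrongPaths and allFalseReads of row 0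
    fetch : ∀ {w f} → r (cell 0 3) ≡ + w → r (cell 0 4) ≡ + f → decider ⊢ config 17 r [] [] ↝⟨ 6 ⟩
            config 114 (updZ (updZ (updZ (updZ r 8 (+ 19)) 11 (+ w)) 8 (+ 20)) 12 (+ f)) [] []
    fetch rw rf = tra-fall refl count ▸ tra-jump refl one ▸ step refl ▸ ldind-step refl refl rw ▸
                  step refl ▸ ldind-step refl refl rf ▸ done
    verdict : ∀ w f c → r (cell 0 3) ≡ + w → r (cell 0 4) ≡ + f → r 6 ≡ + c →
              runRAM 20 decider (config 17 r [] []) ≡ just (boolToℤ (does ((w ≟ 0) ×-dec (f ≟ c))) ∷ [])
    verdict (suc w) f c rw rf rc =
      halts (fetch rw rf ++↝ (tra-jump refl refl ▸ step refl ▸ done)) refl zero15 (≤ᵇ⇒≤ 8 19 _)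
    verdict zero f c rw rf rc with <-cmp f c
    ... | tri< f<c f≢c _ rewrite dec-false (f ≟ c) f≢c =
      halts (fetch rw rf ++↝ (tra-fall refl refl ▸ sub-step refl refl rc ▸
                              tra-fall refl refl {{m≤n⇒nonPositive (<⇒≤ f<c)}} ▸ sub-step refl rc refl ▸
                              tra-jump refl (n<m⇒m-n≡suc f<c) ▸ step refl ▸ done))
            refl zero15 (≤ᵇ⇒≤ 12 19 _)
    ... | tri≈ _ refl _ rewrite dec-true (f ≟ f) refl =
      halts (fetch rw rf ++↝ (tra-fall refl refl ▸ sub-step refl refl rc ▸
                              tra-fall refl refl {{m≤n⇒nonPositive (≤-refl {f})}} ▸ sub-step refl rc refl ▸
                              tra-fall refl refl {{m≤n⇒nonPositive (≤-refl {f})}} ▸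
                              step refl ▸ tra-jump refl one ▸ done))
            refl one (≤ᵇ⇒≤ 13 19 _)
    ... | tri> _ f≢c c<f rewrite dec-false (f ≟ c) f≢c =
      halts (fetch rw rf ++↝ (tra-fall refl refl ▸ sub-step refl refl rc ▸
                              tra-jump refl (n<m⇒m-n≡suc c<f) ▸ step refl ▸ done))
            refl zero15 (≤ᵇ⇒≤ 10 19 _)

  summarise-all : ∀ q {r} → Summarised q r →
    runRAM (q * 60 + 20) decider (config 17 r [] []) ≡ just (boolToℤ (does (accepting? X)) ∷ [])
  summarise-all zero    S = finish S
  summarise-all (suc p) S with k , _ , k≤60 , steps , S' ← iteration S =
    runRAM-mono (runRAM-↝ steps (summarise-all p S')) (+-monoˡ-≤ (p * 60 + 20) k≤60)

  start : ∀ n m → ∃ λ r →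
    decider ⊢ initConfig (encodeInput n m X) ↝⟨ 4 ⟩ config 4 r (concatMap encodeInstr X) [] × Loaded 0 r
  start n m = _ , (step refl ▸ step refl ▸ step refl ▸ step refl ▸ done) ,
    record { one = refl ; count = refl ; pointer = refl ; noReads = refl ; zero15 = refl ; instrs = λ _ () }

  decides : ∀ n m →
    runRAM (N * 72 + 24) decider (initConfig (encodeInput n m X)) ≡ just (boolToℤ (does (accepting? X)) ∷ [])
  decides n m with _ , s₀ , L ← start n m with k , _ , k≤ , s₁ , S ← load-all gX L refl =
    runRAM-mono (runRAM-↝ (s₀ ++↝ s₁) (summarise-all N S))
                (≤-trans (+-monoˡ-≤ (N * 60 + 20) (+-monoʳ-≤ 4 k≤)) (≤-reflexive (time N)))
    where
    time : ∀ N → 4 + N * 12 + (N * 60 + 20) ≡ N * 72 + 24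
    time = solve-∀

-- The time bound

L≤ : ∀ n → L n ≤ 3 * n + 3
L≤ n = by-parity (n % 2 ≡ᵇ 0)
  where
  by-parity : ∀ b → (if b then 3 * n / 2 + 1 else 3 * (n + 1) / 2) ≤ 3 * n + 3
  by-parity true  = ≤-trans (+-monoˡ-≤ 1 (m/n≤m (3 * n) 2)) (+-monoʳ-≤ (3 * n) (s≤s z≤n))
  by-parity false = ≤-trans (m/n≤m (3 * (n + 1)) 2) (≤-reflexive (*-distribˡ-+ 3 n 1))

time-bound : ∀ {n m N} → 1 ≤ n → 1 ≤ m → N ≡ L n + m → N * 72 + 24 ≤ 576 * (n * (n + m))
time-bound {n@(suc _)} {m} 1≤n 1≤m refl = begin
  N * 72 + 24          ≤⟨ +-monoʳ-≤ (N * 72) (*-monoˡ-≤ 24 (≤-trans 1≤m (m≤n+m m (L n)))) ⟩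
  N * 72 + N * 24      ≡⟨ sym (*-distribˡ-+ N 72 24) ⟩
  N * 96               ≤⟨ *-monoˡ-≤ 96 N≤ ⟩
  6 * (n + m) * 96     ≡⟨ rearrange n m ⟩
  576 * (n + m)        ≤⟨ *-monoʳ-≤ 576 (m≤n*m (n + m) n) ⟩
  576 * (n * (n + m))  ∎
  where
  open ≤-Reasoning
  N : ℕ
  N = L n + m
  rearrange : ∀ n m → 6 * (n + m) * 96 ≡ 576 * (n + m)
  rearrange = solve-∀
  N≤ : N ≤ 6 * (n + m)
  N≤ = begin
    L n + m              ≤⟨ +-monoˡ-≤ m (L≤ n) ⟩
    3 * n + 3 + m        ≤⟨ +-monoˡ-≤ m (+-monoʳ-≤ (3 * n) (*-monoʳ-≤ 3 1≤n)) ⟩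
    3 * n + 3 * n + m    ≤⟨ +-monoʳ-≤ (3 * n + 3 * n) (m≤n*m m 6) ⟩
    3 * n + 3 * n + 6 * m ≡⟨ split n m ⟩
    6 * (n + m)          ∎
    where
    split : ∀ n m → 3 * n + 3 * n + 6 * m ≡ 6 * (n + m)
    split = solve-∀

does≡true⇔ : ∀ {P : Set} (P? : Dec P) → does P? ≡ true ⇔ P
does≡true⇔ (yes p) = mk⇔ (λ _ → p) (λ _ → refl)
does≡true⇔ (no ¬p) = mk⇔ (λ ()) (λ p → contradiction p ¬p)

lemma5 : ∃ λ (P : RAMProg) → ∃ λ (c : ℕ) →
    (n m : ℕ) → 1 ≤ n → 1 ≤ m → (X : InstrSeq) →
    VeryGood X → len X ≡ L n + m → IregsIs1toN X n →
    ∃ λ (b : Bool) →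
      runRAM (c * (n * (n + m))) P (initConfig (encodeInput n m X)) ≡ just (boolToℤ b ∷ [])
      × (b ≡ true ⇔ Computes n (tstnz n) X)
lemma5 = decider , 576 , λ n m 1≤n 1≤m X veryGood len≡ iregs →
  does (accepting? X) ,
  runRAM-mono (Decider.decides X (Good⇒GoodSeq (proj₁ veryGood)) n m) (time-bound 1≤n 1≤m len≡) ,
  ⇔-trans (does≡true⇔ (accepting? X)) (accepting⇔computes-tstnz veryGood iregs)
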